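{- Let $(T_n)_{n\ge0}$ be a sequence of real numbers with $T_n\ne0$ for all $n$, and let $\alpha,\beta$ be indeterminates. Define polynomials $g_n(\alpha)$ by $g_{ -1}(\alpha)=0$, $g_0(\alpha)=1$ and, for $n\ge1$, $$g_{2n}(\alpha)=\alpha g_{2n-1}(\alpha)+T_{2n-2}g_{2n-2}(\alpha),\qquad g_{2n+1}(\alpha)=g_{2n}(\alpha)+T_{2n-1}g_{2n-1}(\alpha)$$ (also $g_1(\alpha)=g_0(\alpha)+T_{ -1}g_{ -1}(\alpha)=1$). Define $c(n,k)$ for integers $n\ge0$, $k\ge -1$ by $c(0,k)=[k=0]$, $c(n,-1)=0$, and $$c(n,k)=c(n-1,k-1)+T_k\,c(n-1,k+1),\quad n\ge1,\ k\ge0,$$ and set $c_n=c(2n,0)$. Then for all positive integers $n$, $$\frac{\det\left(\alpha\beta c_{i+j}+(\alpha+\beta)c_{i+j+1}+c_{i+j+2}\right)_{i,j=0}^{n-1}}{\det\left(c_{i+j}\right)_{i,j=0}^{n-1}}=\sum_{j=0}^n T_{2j}T_{2j+1}\cdots T_{2n-1}\,g_{2j}(\alpha)g_{2j}(\beta)$$ and $$\frac{\det\left(\alpha\beta c_{i+j+1}+(\alpha+\beta)c_{i+j+2}+c_{i+j+3}\right)_{i,j=0}^{n-1}}{\det\left(c_{i+j+1}\right)_{i,j=0}^{n-1}}=\sum_{j=0}^n T_{2j+1}T_{2j+2}\cdots T_{2n}\,g_{2j+1}(\alpha)g_{2j+1}(\beta).$$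
   Context: $[\mathcal A]$ denotes the Iverson bracket. An empty product (e.g. $T_{2n}\cdots T_{2n-1}$ for $j=n$) equals $1$. Combinatorially, $c(n,k)$ is the total weight of paths from $(0,0)$ to $(n,k)$ with steps $(1,1)$ and $(1,-1)$ never going below the $x$-axis, where up-steps have weight $1$ and a down-step ending at height $h$ has weight $T_h$. -}

module Defs where

open import Level using (Level)
open import Data.Nat using (ℕ; zero; suc) renaming (_*_ to _*ℕ_)
open import Data.Fin using (Fin; zero; suc; toℕ; punchIn)
open import Data.Product using (Σ; _×_)
open import Relation.Nullary using (¬_)
open import Algebra.Bundles using (CommutativeRing)

record IsField {c ℓ : Level} (R : CommutativeRing c ℓ) : Set (Level._⊔_ c ℓ) where
  open CommutativeRing R
  field
    1≉0 : ¬ (1# ≈ 0#)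
    inverse : ∀ x → ¬ (x ≈ 0#) → Σ Carrier (λ y → x * y ≈ 1#)

module _ {c ℓ : Level} (R : CommutativeRing c ℓ) where
  open CommutativeRing R using (Carrier; 0#; 1#; -_) renaming (_+_ to _⊕_; _*_ to _⊗_)

  ΣFin : (n : ℕ) → (Fin n → Carrier) → Carrier
  ΣFin zero f = 0#
  ΣFin (suc n) f = f zero ⊕ ΣFin n (λ i → f (suc i))

  Σto : ℕ → (ℕ → Carrier) → Carrier
  Σto zero f = f 0
  Σto (suc n) f = Σto n f ⊕ f (suc n)

  sgn : ℕ → Carrier
  sgn zero = 1#
  sgn (suc m) = - sgn m

  det : (n : ℕ) → (Fin n → Fin n → Carrier) → Carrier
  det zero M = 1#
  det (suc n) M =
    ΣFin (suc n) (λ j → sgn (toℕ j) ⊗ (M zero j ⊗ det n (λ i k → M (suc i) (punchIn j k))))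

  module _ (T : ℕ → Carrier) where

    prodT : ℕ → ℕ → Carrier
    prodT a zero = 1#
    prodT a (suc len) = T a ⊗ prodT (suc a) len

    -- c k n  =  c(n,k) of the paper, for k ≥ 0 (c(n,-1) = 0 is built in)
    cnk : ℕ → ℕ → Carrier
    cnk zero zero = 1#
    cnk zero (suc k) = 0#
    cnk (suc n) zero = T 0 ⊗ cnk n 1
    cnk (suc n) (suc k) = cnk n k ⊕ (T (suc k) ⊗ cnk n (suc (suc k)))

    cseq : ℕ → Carrier
    cseq n = cnk (2 *ℕ n) 0

    module _ (α : Carrier) where
      -- gE n = g_{2n}(α),  gO n = g_{2n+1}(α)
      gE : ℕ → Carrier
      gO : ℕ → Carrier
      gE zero = 1#
      gE (suc n) = (α ⊗ gO n) ⊕ (T (2 *ℕ n) ⊗ gE n)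
      gO zero = 1#
      gO (suc n) = gE (suc n) ⊕ (T (suc (2 *ℕ n)) ⊗ gO n)

-- Cutting a path from height 0 to height 0 after r + 2i steps (r ∈ {0,1}) gives the factorisation
-- c_{i+j+r} = Σ_{k<n} L_{ik} w_k L_{jk} with L_{ik} = c(r+2i, r+2k) unitriangular and w_k = T_0 ⋯ T_{r+2k-1},
-- so the Hankel determinant is ∏_{k<n} w_k, nonzero in a field. The same cut writes the modified Hankel matrix
-- as Σ_{k≤n} P^α_{ik} w_k P^β_{jk} with P^γ_{ik} = c(r+2i+2, r+2k) + γ c(r+2i, r+2k). On the columns k < n,
-- the two-step recurrence of c gives P^γ = L J^γ with J^γ tridiagonal, and det J^γ obeys the three-term
-- recurrence of g_{2n+r}(γ); the column k = n is a unit vector. A rank-one update of the bottom-right corner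
-- therefore gives D_n = g_{2n+r}(α) g_{2n+r}(β) ∏_{k<n} w_k + w_n D_{n-1} for the modified determinant D_n,
-- which telescopes to the stated sum.

module Submission where

open import Defs
open import Level using (Level; _⊔_)
open import Data.Nat using (ℕ; zero; suc; _∸_; _≥_; z≤n; s≤s) renaming (_+_ to _+ℕ_; _*_ to _*ℕ_)
import Data.Nat as ℕ
import Data.Nat.Properties as ℕP
open import Data.Fin using (Fin; zero; suc; toℕ; punchIn; punchOut; inject₁; fromℕ; fromℕ<; _≟_)
import Data.Fin.Properties as FinP
open import Data.Bool using (if_then_else_)
open import Data.Product using (∃; _×_; _,_; proj₁; proj₂)
open import Data.Sum using (_⊎_; inj₁; inj₂)
open import Data.Empty using (⊥-elim)
open import Relation.Nullary using (¬_; Dec; yes; no; does)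
open import Relation.Nullary.Decidable using (dec-true; dec-false)
open import Relation.Binary.Definitions using (tri<; tri≈; tri>)
open import Relation.Binary.PropositionalEquality as ≡ using (_≡_; _≢_)
open import Algebra.Bundles using (CommutativeRing)
open import Data.Nat.Tactic.RingSolver using (solve-∀)
import Algebra.Solver.Ring.NaturalCoefficients.Default as SemiringSolver
import Algebra.Properties.Ring as RingProperties
import Algebra.Properties.AbelianGroup as AbelianGroupProperties
import Relation.Binary.Reasoning.Setoid as SetoidReasoning

double : ℕ → ℕ
double zero    = zero
double (suc n) = suc (suc (double n))

double≡2* : ∀ n → double n ≡ 2 *ℕ n
double≡2* zero    = ≡.refl
double≡2* (suc n) = ≡.trans (≡.cong (λ x → suc (suc x)) (double≡2* n)) (≡.sym (ℕP.*-suc 2 n))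

double-mono-≤ : ∀ {i k} → i ℕ.≤ k → double i ℕ.≤ double k
double-mono-≤ z≤n       = z≤n
double-mono-≤ (s≤s i≤k) = s≤s (s≤s (double-mono-≤ i≤k))

double-mono-< : ∀ {i k} → i ℕ.< k → double i ℕ.< double k
double-mono-< i<k = ℕP.≤-trans (ℕP.n≤1+n _) (double-mono-≤ i<k)

offset-double-< : ∀ {r i N} → r ℕ.≤ 1 → i ℕ.< N → r +ℕ double i ℕ.< double N
offset-double-< {i = i} r≤1 i<N = ℕP.<-≤-trans (s≤s (ℕP.+-monoˡ-≤ (double i) r≤1)) (double-mono-≤ i<N)

punchIn-adjacent : ∀ {m} (c k : Fin m) →
  punchIn (inject₁ c) k ≡ punchIn (suc c) k ⊎ (punchIn (inject₁ c) k ≡ suc c × punchIn (suc c) k ≡ inject₁ c)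
punchIn-adjacent zero    zero    = inj₂ (≡.refl , ≡.refl)
punchIn-adjacent zero    (suc k) = inj₁ ≡.refl
punchIn-adjacent (suc c) zero    = inj₁ ≡.refl
punchIn-adjacent (suc c) (suc k) with punchIn-adjacent c k
... | inj₁ eq         = inj₁ (≡.cong suc eq)
... | inj₂ (eq , eq′) = inj₂ (≡.cong suc eq , ≡.cong suc eq′)

punchIn-avoiding-adjacent : ∀ {m} (j : Fin (suc (suc m))) (c : Fin (suc m)) → j ≢ inject₁ c → j ≢ suc c →
  ∃ λ c′ → punchIn j (inject₁ c′) ≡ inject₁ c × punchIn j (suc c′) ≡ suc c
punchIn-avoiding-adjacent                 zero          zero    j≢c _     = ⊥-elim (j≢c ≡.refl)
punchIn-avoiding-adjacent                 zero          (suc c) _   _     = c , ≡.refl , ≡.refl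
punchIn-avoiding-adjacent                 (suc zero)    zero    _   j≢c+1 = ⊥-elim (j≢c+1 ≡.refl)
punchIn-avoiding-adjacent {suc m}         (suc (suc j)) zero    _   _     = zero , ≡.refl , ≡.refl
punchIn-avoiding-adjacent {suc m} (suc j) (suc c) j≢c j≢c+1
  with punchIn-avoiding-adjacent j c (λ eq → j≢c (≡.cong suc eq)) (λ eq → j≢c+1 (≡.cong suc eq))
... | c′ , eq , eq′ = suc c′ , ≡.cong suc eq , ≡.cong suc eq′

punchIn-elim : ∀ {m p} (j : Fin (suc m)) (P : Fin (suc m) → Set p) → P j → (∀ k → P (punchIn j k)) → ∀ t → P t
punchIn-elim j P Pj Pk t with t ≟ j
... | yes ≡.refl = Pj
... | no t≢j     = ≡.subst P (FinP.punchIn-punchOut j≢t) (Pk (punchOut j≢t))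
  where
  j≢t : j ≢ t
  j≢t j≡t = t≢j (≡.sym j≡t)

punchIn-inject₁-self : ∀ {m} (c : Fin m) → punchIn (inject₁ c) c ≡ suc c
punchIn-inject₁-self zero    = ≡.refl
punchIn-inject₁-self (suc c) = ≡.cong suc (punchIn-inject₁-self c)

punchIn-suc-self : ∀ {m} (c : Fin m) → punchIn (suc c) c ≡ inject₁ c
punchIn-suc-self zero    = ≡.refl
punchIn-suc-self (suc c) = ≡.cong suc (punchIn-suc-self c)

punchIn-inject₁ : ∀ {m} (j : Fin (suc m)) (k : Fin m) → punchIn (inject₁ j) (inject₁ k) ≡ inject₁ (punchIn j k)
punchIn-inject₁ zero    k       = ≡.refl
punchIn-inject₁ (suc j) zero    = ≡.refl
punchIn-inject₁ (suc j) (suc k) = ≡.cong suc (punchIn-inject₁ j k)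

punchIn-inject₁-last : ∀ {m} (j : Fin (suc m)) → punchIn (inject₁ j) (fromℕ m) ≡ fromℕ (suc m)
punchIn-inject₁-last         zero    = ≡.refl
punchIn-inject₁-last {suc m} (suc j) = ≡.cong suc (punchIn-inject₁-last j)

punchIn-last : ∀ {m} (k : Fin m) → punchIn (fromℕ m) k ≡ inject₁ k
punchIn-last zero    = ≡.refl
punchIn-last (suc k) = ≡.cong suc (punchIn-last k)

module LinearAlgebra {c ℓ : Level} (R : CommutativeRing c ℓ) where

  open CommutativeRing R hiding (zero)
  open RingProperties ring using (-‿distribˡ-*; -‿distribʳ-*; -‿involutive)
  open AbelianGroupProperties +-abelianGroup using (inverseʳ-unique)
  open SemiringSolver commutativeSemiring using (solve; _:+_; _:*_; _:=_; con)
  open SetoidReasoning setoid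

  Matrix : ℕ → Set c
  Matrix n = Fin n → Fin n → Carrier

  ∑ : (n : ℕ) → (Fin n → Carrier) → Carrier
  ∑ = ΣFin R

  ∑-cong : ∀ n {f g : Fin n → Carrier} → (∀ i → f i ≈ g i) → ∑ n f ≈ ∑ n g
  ∑-cong zero    f≈g = refl
  ∑-cong (suc n) f≈g = +-cong (f≈g zero) (∑-cong n (λ i → f≈g (suc i)))

  ∑-zero : ∀ n {f : Fin n → Carrier} → (∀ i → f i ≈ 0#) → ∑ n f ≈ 0#
  ∑-zero zero    f≈0 = refl
  ∑-zero (suc n) f≈0 = trans (+-cong (f≈0 zero) (∑-zero n (λ i → f≈0 (suc i)))) (+-identityʳ 0#)

  ∑-+ : ∀ n (f g : Fin n → Carrier) → ∑ n (λ i → f i + g i) ≈ ∑ n f + ∑ n g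
  ∑-+ zero    f g = sym (+-identityʳ 0#)
  ∑-+ (suc n) f g = trans (+-cong refl (∑-+ n (λ i → f (suc i)) (λ i → g (suc i))))
    (solve 4 (λ a b x y → (a :+ b) :+ (x :+ y) := (a :+ x) :+ (b :+ y)) refl
       (f zero) (g zero) (∑ n (λ i → f (suc i))) (∑ n (λ i → g (suc i))))

  *-distribˡ-∑ : ∀ n a (f : Fin n → Carrier) → a * ∑ n f ≈ ∑ n (λ i → a * f i)
  *-distribˡ-∑ zero    a f = zeroʳ a
  *-distribˡ-∑ (suc n) a f = trans (distribˡ a _ _) (+-cong refl (*-distribˡ-∑ n a (λ i → f (suc i))))

  *-distribʳ-∑ : ∀ n a (f : Fin n → Carrier) → ∑ n f * a ≈ ∑ n (λ i → f i * a)
  *-distribʳ-∑ n a f = trans (*-comm _ a) (trans (*-distribˡ-∑ n a f) (∑-cong n (λ i → *-comm a (f i))))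

  ∑-linear : ∀ n a b (f g : Fin n → Carrier) →
             ∑ n (λ i → a * f i + b * g i) ≈ a * ∑ n f + b * ∑ n g
  ∑-linear n a b f g = trans (∑-+ n _ _) (+-cong (sym (*-distribˡ-∑ n a f)) (sym (*-distribˡ-∑ n b g)))

  ∑-comm : ∀ n m (f : Fin n → Fin m → Carrier) →
           ∑ n (λ i → ∑ m (f i)) ≈ ∑ m (λ j → ∑ n (λ i → f i j))
  ∑-comm zero    m f = sym (∑-zero m (λ _ → refl))
  ∑-comm (suc n) m f = trans (+-cong refl (∑-comm n m (λ i → f (suc i)))) (sym (∑-+ m (f zero) _))

  ∑-last : ∀ n (f : Fin (suc n) → Carrier) → ∑ (suc n) f ≈ ∑ n (λ i → f (inject₁ i)) + f (fromℕ n)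
  ∑-last zero    f = trans (+-identityʳ _) (sym (+-identityˡ _))
  ∑-last (suc n) f = trans (+-cong refl (∑-last n (λ i → f (suc i)))) (sym (+-assoc _ _ _))

  δ : ∀ {n} → Fin n → Fin n → Carrier
  δ i j = if does (i ≟ j) then 1# else 0#

  δ-refl : ∀ {n} (i : Fin n) → δ i i ≈ 1#
  δ-refl i with i ≟ i
  ... | yes _   = refl
  ... | no i≢i = ⊥-elim (i≢i ≡.refl)

  δ-≢ : ∀ {n} {i j : Fin n} → i ≢ j → δ i j ≈ 0#
  δ-≢ {i = i} {j} i≢j with i ≟ j
  ... | yes i≡j = ⊥-elim (i≢j i≡j)
  ... | no _    = refl

  δ-sym : ∀ {n} (i j : Fin n) → δ i j ≈ δ j i
  δ-sym i j with i ≟ j | j ≟ i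
  ... | yes _   | yes _   = refl
  ... | no _    | no _    = refl
  ... | yes i≡j | no j≢i = ⊥-elim (j≢i (≡.sym i≡j))
  ... | no i≢j | yes j≡i = ⊥-elim (i≢j (≡.sym j≡i))

  ∑-δ : ∀ n (f : Fin n → Carrier) k → ∑ n (λ t → f t * δ t k) ≈ f k
  ∑-δ (suc n) f zero    = trans (+-cong (*-identityʳ _) (∑-zero n (λ _ → zeroʳ _))) (+-identityʳ _)
  ∑-δ (suc n) f (suc k) = trans (+-cong (zeroʳ _) (∑-δ n (λ t → f (suc t)) k)) (+-identityˡ _)

  δℕ : ℕ → ℕ → Carrier
  δℕ a b = if a ℕ.≡ᵇ b then 1# else 0#

  δℕ-refl : ∀ a → δℕ a a ≈ 1#
  δℕ-refl zero    = refl
  δℕ-refl (suc a) = δℕ-refl a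

  δℕ-≢ : ∀ {a b} → a ≢ b → δℕ a b ≈ 0#
  δℕ-≢ {zero}  {zero}  a≢b = ⊥-elim (a≢b ≡.refl)
  δℕ-≢ {zero}  {suc b} _   = refl
  δℕ-≢ {suc a} {zero}  _   = refl
  δℕ-≢ {suc a} {suc b} a≢b = δℕ-≢ (λ a≡b → a≢b (≡.cong suc a≡b))

  δℕ-sym : ∀ a b → δℕ a b ≈ δℕ b a
  δℕ-sym zero    zero    = refl
  δℕ-sym zero    (suc b) = refl
  δℕ-sym (suc a) zero    = refl
  δℕ-sym (suc a) (suc b) = δℕ-sym a b

  δ≈δℕ : ∀ {n} (i j : Fin n) → δ i j ≈ δℕ (toℕ i) (toℕ j)
  δ≈δℕ i j with i ≟ j
  ... | yes ≡.refl = sym (δℕ-refl (toℕ i))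
  ... | no i≢j     = sym (δℕ-≢ (λ eq → i≢j (FinP.toℕ-injective eq)))

  ∑ℕ : ℕ → (ℕ → Carrier) → Carrier
  ∑ℕ zero    f = 0#
  ∑ℕ (suc N) f = f 0 + ∑ℕ N (λ h → f (suc h))

  ∑ℕ-cong : ∀ N {f g : ℕ → Carrier} → (∀ h → h ℕ.< N → f h ≈ g h) → ∑ℕ N f ≈ ∑ℕ N g
  ∑ℕ-cong zero    f≈g = refl
  ∑ℕ-cong (suc N) f≈g = +-cong (f≈g 0 (s≤s z≤n)) (∑ℕ-cong N (λ h h<N → f≈g (suc h) (s≤s h<N)))

  ∑ℕ-zero : ∀ N {f : ℕ → Carrier} → (∀ h → h ℕ.< N → f h ≈ 0#) → ∑ℕ N f ≈ 0#
  ∑ℕ-zero zero    f≈0 = refl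
  ∑ℕ-zero (suc N) f≈0 =
    trans (+-cong (f≈0 0 (s≤s z≤n)) (∑ℕ-zero N (λ h h<N → f≈0 (suc h) (s≤s h<N)))) (+-identityʳ 0#)

  ∑ℕ-+ : ∀ N (f g : ℕ → Carrier) → ∑ℕ N (λ h → f h + g h) ≈ ∑ℕ N f + ∑ℕ N g
  ∑ℕ-+ zero    f g = sym (+-identityʳ 0#)
  ∑ℕ-+ (suc N) f g = trans (+-cong refl (∑ℕ-+ N _ _))
    (solve 4 (λ a b x y → (a :+ b) :+ (x :+ y) := (a :+ x) :+ (b :+ y)) refl
       (f 0) (g 0) (∑ℕ N (λ h → f (suc h))) (∑ℕ N (λ h → g (suc h))))

  *-distribˡ-∑ℕ : ∀ N a (f : ℕ → Carrier) → a * ∑ℕ N f ≈ ∑ℕ N (λ h → a * f h)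
  *-distribˡ-∑ℕ zero    a f = zeroʳ a
  *-distribˡ-∑ℕ (suc N) a f = trans (distribˡ a _ _) (+-cong refl (*-distribˡ-∑ℕ N a _))

  ∑ℕ-last : ∀ N (f : ℕ → Carrier) → ∑ℕ (suc N) f ≈ ∑ℕ N f + f N
  ∑ℕ-last zero    f = trans (+-identityʳ _) (sym (+-identityˡ _))
  ∑ℕ-last (suc N) f = trans (+-cong refl (∑ℕ-last N (λ h → f (suc h)))) (sym (+-assoc _ _ _))

  ∑ℕ-δ : ∀ N (f : ℕ → Carrier) k → k ℕ.< N → ∑ℕ N (λ h → f h * δℕ h k) ≈ f k
  ∑ℕ-δ (suc N) f zero    _         =
    trans (+-cong (trans (*-cong refl (δℕ-refl 0)) (*-identityʳ _))
                  (∑ℕ-zero N (λ h _ → trans (*-cong refl (δℕ-≢ {suc h} {0} (λ ()))) (zeroʳ _))))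
          (+-identityʳ _)
  ∑ℕ-δ (suc N) f (suc k) (s≤s k<N) =
    trans (+-cong (trans (*-cong refl (δℕ-≢ {0} {suc k} (λ ()))) (zeroʳ _)) (∑ℕ-δ N (λ h → f (suc h)) k k<N)) (+-identityˡ _)

  ∑ℕ-δ-outside : ∀ N (f : ℕ → Carrier) k → N ℕ.≤ k → ∑ℕ N (λ h → f h * δℕ h k) ≈ 0#
  ∑ℕ-δ-outside N f k N≤k =
    ∑ℕ-zero N (λ h h<N → trans (*-cong refl (δℕ-≢ (λ h≡k → ℕP.<-irrefl h≡k (ℕP.<-≤-trans h<N N≤k)))) (zeroʳ _))

  ∑ℕ-pairs : ∀ N (f : ℕ → Carrier) → ∑ℕ (double N) f ≈ ∑ℕ N (λ k → f (double k) + f (suc (double k)))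
  ∑ℕ-pairs zero    f = refl
  ∑ℕ-pairs (suc N) f = trans (sym (+-assoc _ _ _)) (+-cong refl (∑ℕ-pairs N (λ h → f (suc (suc h)))))

  Σto-cong≤ : ∀ n {f g : ℕ → Carrier} → (∀ j → j ℕ.≤ n → f j ≈ g j) → Σto R n f ≈ Σto R n g
  Σto-cong≤ zero    f≈g = f≈g 0 z≤n
  Σto-cong≤ (suc n) f≈g = +-cong (Σto-cong≤ n (λ j j≤n → f≈g j (ℕP.m≤n⇒m≤1+n j≤n))) (f≈g (suc n) ℕP.≤-refl)

  Σto-*ʳ : ∀ n (f : ℕ → Carrier) x → Σto R n (λ j → f j * x) ≈ Σto R n f * x
  Σto-*ʳ zero    f x = refl
  Σto-*ʳ (suc n) f x = trans (+-cong (Σto-*ʳ n f x) refl) (sym (distribʳ _ _ _))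

  ∑-toℕ : ∀ n (f : ℕ → Carrier) → ∑ n (λ k → f (toℕ k)) ≈ ∑ℕ n f
  ∑-toℕ zero    f = refl
  ∑-toℕ (suc n) f = +-cong refl (∑-toℕ n (λ h → f (suc h)))

  1ᴹ : ∀ {n} → Matrix n
  1ᴹ = δ

  _ᵀ : ∀ {n} → Matrix n → Matrix n
  (X ᵀ) i j = X j i

  setRow : ∀ {n} → Matrix n → Fin n → (Fin n → Carrier) → Matrix n
  setRow X r u i j = if does (i ≟ r) then u j else X i j

  setRow-≡ : ∀ {n} (X : Matrix n) r u j → setRow X r u r j ≈ u j
  setRow-≡ X r u j with r ≟ r
  ... | yes _   = refl
  ... | no r≢r = ⊥-elim (r≢r ≡.refl)

  setRow-≢ : ∀ {n} (X : Matrix n) r u {i} j → i ≢ r → setRow X r u i j ≈ X i j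
  setRow-≢ X r u {i} j i≢r with i ≟ r
  ... | yes i≡r = ⊥-elim (i≢r i≡r)
  ... | no _    = refl

  setRow-congˡ : ∀ {n} (X Y : Matrix n) r u {i} → (∀ j → X i j ≈ Y i j) → ∀ j → setRow X r u i j ≈ setRow Y r u i j
  setRow-congˡ X Y r u {i} Xᵢ≈Yᵢ j with i ≟ r
  ... | yes _ = refl
  ... | no _  = Xᵢ≈Yᵢ j

  minor : ∀ {n} → Fin (suc n) → Matrix (suc n) → Matrix n
  minor j X a b = X (suc a) (punchIn j b)

  laplaceTerm : ∀ {n} → Matrix (suc n) → Fin (suc n) → Carrier
  laplaceTerm {n} X j = sgn R (toℕ j) * (X zero j * det R n (minor j X))

  Extensional : ∀ n → (Matrix n → Carrier) → Set (c ⊔ ℓ)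
  Extensional n D = ∀ {X Y} → (∀ i j → X i j ≈ Y i j) → D X ≈ D Y

  det-cong : ∀ n → Extensional n (det R n)
  det-cong zero    X≈Y = refl
  det-cong (suc n) {X} {Y} X≈Y = ∑-cong (suc n) {laplaceTerm X} {laplaceTerm Y} (λ j →
    *-cong refl (*-cong (X≈Y zero j) (det-cong n (λ a b → X≈Y (suc a) (punchIn j b)))))

  RowLinear : ∀ n → (Matrix n → Carrier) → Set (c ⊔ ℓ)
  RowLinear n D = ∀ r a b (X Y Z : Matrix n) →
    (∀ j → X r j ≈ a * Y r j + b * Z r j) →
    (∀ i → i ≢ r → ∀ j → X i j ≈ Y i j × X i j ≈ Z i j) →
    D X ≈ a * D Y + b * D Z

  det-rowLinear : ∀ n → RowLinear n (det R n)
  det-rowLinear (suc n) zero a b X Y Z row₀ others =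
    trans (∑-cong (suc n) term) (∑-linear (suc n) a b (laplaceTerm Y) (laplaceTerm Z))
    where
    minorX≈Y : ∀ j → det R n (minor j X) ≈ det R n (minor j Y)
    minorX≈Y j = det-cong n (λ p _ → proj₁ (others (suc p) (λ ()) _))
    minorX≈Z : ∀ j → det R n (minor j X) ≈ det R n (minor j Z)
    minorX≈Z j = det-cong n (λ p _ → proj₂ (others (suc p) (λ ()) _))
    term : ∀ j → laplaceTerm X j ≈ a * laplaceTerm Y j + b * laplaceTerm Z j
    term j = begin
      sgn R (toℕ j) * (X zero j * det R n (minor j X))
        ≈⟨ *-cong refl (*-cong (row₀ j) refl) ⟩
      sgn R (toℕ j) * ((a * Y zero j + b * Z zero j) * det R n (minor j X))
        ≈⟨ solve 6 (λ s a b y z d → s :* ((a :* y :+ b :* z) :* d) := a :* (s :* (y :* d)) :+ b :* (s :* (z :* d))) refl _ a b _ _ _ ⟩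
      a * (sgn R (toℕ j) * (Y zero j * det R n (minor j X))) + b * (sgn R (toℕ j) * (Z zero j * det R n (minor j X)))
        ≈⟨ +-cong (*-cong refl (*-cong refl (*-cong refl (minorX≈Y j)))) (*-cong refl (*-cong refl (*-cong refl (minorX≈Z j)))) ⟩
      a * laplaceTerm Y j + b * laplaceTerm Z j ∎
  det-rowLinear (suc n) (suc r) a b X Y Z rowᵣ others =
    trans (∑-cong (suc n) term) (∑-linear (suc n) a b (laplaceTerm Y) (laplaceTerm Z))
    where
    minorLinear : ∀ j → det R n (minor j X) ≈ a * det R n (minor j Y) + b * det R n (minor j Z)
    minorLinear j = det-rowLinear n r a b (minor j X) (minor j Y) (minor j Z) (λ q → rowᵣ (punchIn j q))
      (λ i i≢r q → others (suc i) (λ eq → i≢r (FinP.suc-injective eq)) (punchIn j q))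
    term : ∀ j → laplaceTerm X j ≈ a * laplaceTerm Y j + b * laplaceTerm Z j
    term j = begin
      sgn R (toℕ j) * (X zero j * det R n (minor j X))
        ≈⟨ *-cong refl (*-cong refl (minorLinear j)) ⟩
      sgn R (toℕ j) * (X zero j * (a * det R n (minor j Y) + b * det R n (minor j Z)))
        ≈⟨ solve 6 (λ s x a b p q → s :* (x :* (a :* p :+ b :* q)) := a :* (s :* (x :* p)) :+ b :* (s :* (x :* q))) refl _ _ a b _ _ ⟩
      a * (sgn R (toℕ j) * (X zero j * det R n (minor j Y))) + b * (sgn R (toℕ j) * (X zero j * det R n (minor j Z)))
        ≈⟨ +-cong (*-cong refl (*-cong refl (*-cong (proj₁ (others zero (λ ()) j)) refl)))
                  (*-cong refl (*-cong refl (*-cong (proj₂ (others zero (λ ()) j)) refl))) ⟩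
      a * laplaceTerm Y j + b * laplaceTerm Z j ∎

  columnTerm : ∀ {n} → Matrix (suc n) → Fin (suc n) → Carrier
  columnTerm {n} X i = sgn R (toℕ i) * (X i zero * det R n (λ a b → X (punchIn i a) (suc b)))

  det-columnExpansion : ∀ n (X : Matrix (suc n)) → det R (suc n) X ≈ ∑ (suc n) (columnTerm X)
  det-columnExpansion zero    X = refl
  det-columnExpansion (suc m) X = +-cong refl (begin
      ∑ (suc m) (λ j → (- s j) * (A j * det R (suc m) (minor (suc j) X)))
    ≈⟨ ∑-cong (suc m) {λ j → (- s j) * (A j * det R (suc m) (minor (suc j) X))}
         (λ j → *-cong refl (*-cong refl (det-columnExpansion m (minor (suc j) X)))) ⟩
      ∑ (suc m) (λ j → (- s j) * (A j * ∑ (suc m) (λ i → s i * (B i * D i j))))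
    ≈⟨ ∑-cong (suc m) (λ j → pull (- s j) (A j) (λ i → s i * (B i * D i j))) ⟩
      ∑ (suc m) (λ j → ∑ (suc m) (λ i → (- s j) * (A j * (s i * (B i * D i j)))))
    ≈⟨ ∑-comm (suc m) (suc m) (λ j i → (- s j) * (A j * (s i * (B i * D i j)))) ⟩
      ∑ (suc m) (λ i → ∑ (suc m) (λ j → (- s j) * (A j * (s i * (B i * D i j)))))
    ≈⟨ ∑-cong (suc m) (λ i → ∑-cong (suc m) (λ j → reorder (s j) (A j) (s i) (B i) (D i j))) ⟩
      ∑ (suc m) (λ i → ∑ (suc m) (λ j → (- s i) * (B i * (s j * (A j * D i j)))))
    ≈⟨ ∑-cong (suc m) (λ i → pull (- s i) (B i) (λ j → s j * (A j * D i j))) ⟨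
      ∑ (suc m) (λ i → (- s i) * (B i * ∑ (suc m) (λ j → s j * (A j * D i j)))) ∎)
    where
    s : Fin (suc m) → Carrier
    s k = sgn R (toℕ k)
    A B : Fin (suc m) → Carrier
    A j = X zero (suc j)
    B i = X (suc i) zero
    D : Fin (suc m) → Fin (suc m) → Carrier
    D i j = det R m (λ a b → X (suc (punchIn i a)) (suc (punchIn j b)))
    pull : ∀ a b (f : Fin (suc m) → Carrier) → a * (b * ∑ (suc m) f) ≈ ∑ (suc m) (λ i → a * (b * f i))
    pull a b f = trans (*-cong refl (*-distribˡ-∑ (suc m) b f)) (*-distribˡ-∑ (suc m) a (λ i → b * f i))
    reorder : ∀ sj aj si bi d → (- sj) * (aj * (si * (bi * d))) ≈ (- si) * (bi * (sj * (aj * d)))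
    reorder sj aj si bi d = begin
      (- sj) * (aj * (si * (bi * d)))  ≈⟨ -‿distribˡ-* _ _ ⟨
      - (sj * (aj * (si * (bi * d))))  ≈⟨ -‿cong (solve 5 (λ sj aj si bi d →
                                            sj :* (aj :* (si :* (bi :* d))) := si :* (bi :* (sj :* (aj :* d)))) refl sj aj si bi d) ⟩
      - (si * (bi * (sj * (aj * d))))  ≈⟨ -‿distribˡ-* _ _ ⟩
      (- si) * (bi * (sj * (aj * d)))  ∎

  det-transpose : ∀ n (X : Matrix n) → det R n (X ᵀ) ≈ det R n X
  det-transpose zero    X = refl
  det-transpose (suc n) X = trans
    (∑-cong (suc n) {laplaceTerm (X ᵀ)} (λ j → *-cong refl (*-cong refl (det-transpose n (λ a b → X (punchIn j a) (suc b))))))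
    (sym (det-columnExpansion n X))

  ∑-adjacentPair : ∀ m (f : Fin (suc (suc m)) → Carrier) (c : Fin (suc m)) →
    (∀ j → j ≢ inject₁ c → j ≢ suc c → f j ≈ 0#) → f (inject₁ c) + f (suc c) ≈ 0# → ∑ (suc (suc m)) f ≈ 0#
  ∑-adjacentPair m f zero others pair =
    trans (sym (+-assoc _ _ _)) (trans (+-cong pair (∑-zero m (λ i → others (suc (suc i)) (λ ()) (λ ())))) (+-identityʳ 0#))
  ∑-adjacentPair (suc m) f (suc c) others pair =
    trans (+-cong (others zero (λ ()) (λ ())) (∑-adjacentPair m (λ i → f (suc i)) c others′ pair)) (+-identityʳ 0#)
    where
    others′ : ∀ j → j ≢ inject₁ c → j ≢ suc c → f (suc j) ≈ 0#
    others′ j j≢c j≢c+1 = others (suc j) (λ eq → j≢c (FinP.suc-injective eq)) (λ eq → j≢c+1 (FinP.suc-injective eq))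

  det-equalAdjacentColumns : ∀ n (X : Matrix (suc n)) (c : Fin n) →
    (∀ i → X i (inject₁ c) ≈ X i (suc c)) → det R (suc n) X ≈ 0#
  det-equalAdjacentColumns (suc m) X c cols≈ = ∑-adjacentPair m (laplaceTerm X) c others pair
    where
    others : ∀ j → j ≢ inject₁ c → j ≢ suc c → laplaceTerm X j ≈ 0#
    others j j≢c j≢c+1 with punchIn-avoiding-adjacent j c j≢c j≢c+1
    ... | c′ , eq , eq′ = trans (*-cong refl (*-cong refl minor≈0)) (trans (*-cong refl (zeroʳ _)) (zeroʳ _))
      where
      minor≈0 : det R (suc m) (minor j X) ≈ 0#
      minor≈0 = det-equalAdjacentColumns m (minor j X) c′
        (λ i → ≡.subst₂ (λ u v → X (suc i) u ≈ X (suc i) v) (≡.sym eq) (≡.sym eq′) (cols≈ (suc i)))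
    minors≈ : det R (suc m) (minor (inject₁ c) X) ≈ det R (suc m) (minor (suc c) X)
    minors≈ = det-cong (suc m) (λ a k → entry a k (punchIn-adjacent c k))
      where
      entry : ∀ a k → punchIn (inject₁ c) k ≡ punchIn (suc c) k ⊎ (punchIn (inject₁ c) k ≡ suc c × punchIn (suc c) k ≡ inject₁ c) →
              X (suc a) (punchIn (inject₁ c) k) ≈ X (suc a) (punchIn (suc c) k)
      entry a k (inj₁ eq)         = reflexive (≡.cong (X (suc a)) eq)
      entry a k (inj₂ (eq , eq′)) = ≡.subst₂ (λ u v → X (suc a) u ≈ X (suc a) v) (≡.sym eq) (≡.sym eq′) (sym (cols≈ (suc a)))
    pair : laplaceTerm X (inject₁ c) + laplaceTerm X (suc c) ≈ 0#
    pair = begin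
      sgn R (toℕ (inject₁ c)) * (X zero (inject₁ c) * det R (suc m) (minor (inject₁ c) X)) + (- sgn R (toℕ c)) * y
        ≈⟨ +-cong (*-cong (reflexive (≡.cong (sgn R) (FinP.toℕ-inject₁ c))) (*-cong (cols≈ zero) minors≈)) (sym (-‿distribˡ-* _ _)) ⟩
      sgn R (toℕ c) * y - sgn R (toℕ c) * y
        ≈⟨ -‿inverseʳ _ ⟩
      0# ∎
      where
      y : Carrier
      y = X zero (suc c) * det R (suc m) (minor (suc c) X)

  det-equalAdjacentRows : ∀ n (X : Matrix (suc n)) (c : Fin n) →
    (∀ j → X (inject₁ c) j ≈ X (suc c) j) → det R (suc n) X ≈ 0#
  det-equalAdjacentRows n X c rows≈ = trans (sym (det-transpose (suc n) X)) (det-equalAdjacentColumns n (X ᵀ) c rows≈)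

  twoRows : ∀ {n} → Matrix n → Fin n → Fin n → (Fin n → Carrier) → (Fin n → Carrier) → Matrix n
  twoRows X p q u v = setRow (setRow X q v) p u

  swapRows : ∀ {n} → Fin n → Fin n → Matrix n → Matrix n
  swapRows p q X = twoRows X p q (X q) (X p)

  Alternating : ∀ n → (Matrix n → Carrier) → Set (c ⊔ ℓ)
  Alternating n D = ∀ {p q} → p ≢ q → ∀ X → (∀ j → X p j ≈ X q j) → D X ≈ 0#

  module _ {n} (D : Matrix n → Carrier) (D-cong : Extensional n D) (D-linear : RowLinear n D) where

    rowAdditive : ∀ r (X Y Z : Matrix n) → (∀ j → X r j ≈ Y r j + Z r j) →
                  (∀ i → i ≢ r → ∀ j → X i j ≈ Y i j × X i j ≈ Z i j) → D X ≈ D Y + D Z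
    rowAdditive r X Y Z rowᵣ others =
      trans (D-linear r 1# 1# X Y Z (λ j → trans (rowᵣ j) (sym (+-cong (*-identityˡ _) (*-identityˡ _)))) others)
            (+-cong (*-identityˡ _) (*-identityˡ _))

    -- D vanishes when rows p and q both equal X p + X q; expand that in both rows.
    swapRows-antisymmetric : ∀ {p q} → p ≢ q → (∀ X → (∀ j → X p j ≈ X q j) → D X ≈ 0#) →
                             ∀ X → D X + D (swapRows p q X) ≈ 0#
    swapRows-antisymmetric {p} {q} p≢q alt X = begin
        D X + D (T (X q) (X p))
      ≈⟨ +-cong (trans (sym (D-cong pq≈X)) (sym (trans (+-cong (equalRows (X p)) refl) (+-identityˡ _))))
                (sym (trans (+-cong refl (equalRows (X q))) (+-identityʳ _))) ⟩
        (D (T (X p) (X p)) + D (T (X p) (X q))) + (D (T (X q) (X p)) + D (T (X q) (X q)))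
      ≈⟨ +-cong (splitSecond (X p)) (splitSecond (X q)) ⟨
        D (T (X p) w) + D (T (X q) w)
      ≈⟨ splitFirst ⟨
        D (T w w)
      ≈⟨ equalRows w ⟩
        0# ∎
      where
      T : (Fin n → Carrier) → (Fin n → Carrier) → Matrix n
      T = twoRows X p q
      w : Fin n → Carrier
      w j = X p j + X q j
      atP : ∀ u v j → T u v p j ≈ u j
      atP u v = setRow-≡ (setRow X q v) p u
      atQ : ∀ u v j → T u v q j ≈ v j
      atQ u v j = trans (setRow-≢ (setRow X q v) p u j (λ q≡p → p≢q (≡.sym q≡p))) (setRow-≡ X q v j)
      equalRows : ∀ u → D (T u u) ≈ 0#
      equalRows u = alt (T u u) (λ j → trans (atP u u j) (sym (atQ u u j)))
      pq≈X : ∀ i j → T (X p) (X q) i j ≈ X i j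
      pq≈X i j with i ≟ p | i ≟ q
      ... | yes ≡.refl | _          = refl
      ... | no _       | yes ≡.refl = refl
      ... | no _       | no _       = refl
      offP : ∀ u u′ v {i} → i ≢ p → ∀ j → T u v i j ≈ T u′ v i j
      offP u u′ v i≢p j = trans (setRow-≢ (setRow X q v) p u j i≢p) (sym (setRow-≢ (setRow X q v) p u′ j i≢p))
      offQ : ∀ u v v′ {i} → i ≢ q → ∀ j → T u v i j ≈ T u v′ i j
      offQ u v v′ i≢q = setRow-congˡ (setRow X q v) (setRow X q v′) p u (λ j → trans (setRow-≢ X q v j i≢q) (sym (setRow-≢ X q v′ j i≢q)))
      splitFirst : D (T w w) ≈ D (T (X p) w) + D (T (X q) w)
      splitFirst = rowAdditive p _ _ _ (λ j → trans (atP w w j) (sym (+-cong (atP (X p) w j) (atP (X q) w j))))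
        (λ i i≢p j → offP w (X p) w i≢p j , offP w (X q) w i≢p j)
      splitSecond : ∀ u → D (T u w) ≈ D (T u (X p)) + D (T u (X q))
      splitSecond u = rowAdditive q _ _ _ (λ j → trans (atQ u w j) (sym (+-cong (atQ u (X p) j) (atQ u (X q) j))))
        (λ i i≢q j → offQ u w (X p) i≢q j , offQ u w (X q) i≢q j)

    swapRows-negates : ∀ {p q} → p ≢ q → (∀ X → (∀ j → X p j ≈ X q j) → D X ≈ 0#) →
                       ∀ X → D (swapRows p q X) ≈ - D X
    swapRows-negates p≢q alt X = inverseʳ-unique _ _ (swapRows-antisymmetric p≢q alt X)

  module _ {m} (D : Matrix (suc m) → Carrier) (D-cong : Extensional (suc m) D) (D-linear : RowLinear (suc m) D)
           (adjacent : ∀ X (c : Fin m) → (∀ j → X (inject₁ c) j ≈ X (suc c) j) → D X ≈ 0#) where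

    private
      -- Rows p < q agree: swap row q with row q − 1 and recurse on the smaller distance.
      alternatingUpTo : ∀ k {p q : Fin (suc m)} → toℕ q ≡ k → toℕ p ℕ.< toℕ q →
                        ∀ X → (∀ j → X p j ≈ X q j) → D X ≈ 0#
      alternatingUpTo (suc k) {p} {suc c} q≡k p<q X rows≈ with p ≟ inject₁ c
      ... | yes ≡.refl = adjacent X c rows≈
      ... | no p≢c = begin
          D X                ≈⟨ +-identityʳ _ ⟨
          D X + 0#           ≈⟨ +-cong refl X′≈0 ⟨
          D X + D X′         ≈⟨ swapRows-antisymmetric D D-cong D-linear c≢c+1 (λ Y → adjacent Y c) X ⟩
          0#                 ∎
        where
        X′ : Matrix (suc m)
        X′ = swapRows (inject₁ c) (suc c) X
        c≢c+1 : inject₁ c ≢ suc c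
        c≢c+1 eq = ℕP.1+n≢n (≡.sym (≡.trans (≡.sym (FinP.toℕ-inject₁ c)) (≡.cong toℕ eq)))
        p≢c+1 : p ≢ suc c
        p≢c+1 eq = ℕP.<-irrefl (≡.cong toℕ eq) p<q
        p<c : toℕ p ℕ.< toℕ (inject₁ c)
        p<c = ≡.subst (toℕ p ℕ.<_) (≡.sym (FinP.toℕ-inject₁ c))
                (ℕP.≤∧≢⇒< (ℕP.≤-pred p<q) (λ eq → p≢c (FinP.toℕ-injective (≡.trans eq (≡.sym (FinP.toℕ-inject₁ c))))))
        X′≈0 : D X′ ≈ 0#
        X′≈0 = alternatingUpTo k (≡.trans (FinP.toℕ-inject₁ c) (ℕP.suc-injective q≡k)) p<c X′ (λ j → begin
          X′ p j            ≈⟨ setRow-≢ (setRow X (suc c) (X (inject₁ c))) (inject₁ c) (X (suc c)) j p≢c ⟩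
          setRow X (suc c) (X (inject₁ c)) p j ≈⟨ setRow-≢ X (suc c) (X (inject₁ c)) j p≢c+1 ⟩
          X p j             ≈⟨ rows≈ j ⟩
          X (suc c) j       ≈⟨ setRow-≡ (setRow X (suc c) (X (inject₁ c))) (inject₁ c) (X (suc c)) j ⟨
          X′ (inject₁ c) j  ∎)

    alternatingFromAdjacent : Alternating (suc m) D
    alternatingFromAdjacent {p} {q} p≢q X rows≈ with ℕP.<-cmp (toℕ p) (toℕ q)
    ... | tri< p<q _ _ = alternatingUpTo (toℕ q) ≡.refl p<q X rows≈
    ... | tri≈ _ p≡q _ = ⊥-elim (p≢q (FinP.toℕ-injective p≡q))
    ... | tri> _ _ q<p = alternatingUpTo (toℕ p) ≡.refl q<p X (λ j → sym (rows≈ j))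

  det-alternating : ∀ n → Alternating n (det R n)
  det-alternating (suc n) = alternatingFromAdjacent (det R (suc n)) (det-cong (suc n)) (det-rowLinear (suc n))
                              (det-equalAdjacentRows n)

  det-swapRows : ∀ n {p q : Fin n} → p ≢ q → ∀ X → det R n (swapRows p q X) ≈ - det R n X
  det-swapRows n p≢q = swapRows-negates (det R n) (det-cong n) (det-rowLinear n) p≢q (det-alternating n p≢q)

  record IsAlternatingForm (n : ℕ) (D : Matrix n → Carrier) : Set (c ⊔ ℓ) where
    field
      cong        : Extensional n D
      rowLinear   : RowLinear n D
      alternating : Alternating n D

    zeroRow : ∀ r X → (∀ j → X r j ≈ 0#) → D X ≈ 0#
    zeroRow r X Xᵣ≈0 = trans
      (rowLinear r 0# 0# X X X (λ j → trans (Xᵣ≈0 j) (sym (trans (+-cong (zeroˡ _) (zeroˡ _)) (+-identityʳ _)))) (λ _ _ _ → refl , refl))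
      (trans (+-cong (zeroˡ _) (zeroˡ _)) (+-identityʳ _))

    addRowMultiple : ∀ {r s} → r ≢ s → ∀ a (W Z : Matrix n) → (∀ j → W r j ≈ Z r j + a * Z s j) →
                     (∀ i → i ≢ r → ∀ j → W i j ≈ Z i j) → D W ≈ D Z
    addRowMultiple {r} {s} r≢s a W Z Wᵣ others = begin
      D W                   ≈⟨ rowLinear r 1# a W Z V (λ j → trans (Wᵣ j) (+-cong (sym (*-identityˡ _)) (*-cong refl (sym (setRow-≡ Z r (Z s) j)))))
                                 (λ i i≢r j → others i i≢r j , trans (others i i≢r j) (sym (setRow-≢ Z r (Z s) j i≢r))) ⟩
      1# * D Z + a * D V    ≈⟨ +-cong (*-identityˡ _) (trans (*-cong refl V≈0) (zeroʳ _)) ⟩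
      D Z + 0#              ≈⟨ +-identityʳ _ ⟩
      D Z                   ∎
      where
      V : Matrix n
      V = setRow Z r (Z s)
      V≈0 : D V ≈ 0#
      V≈0 = alternating r≢s V (λ j → trans (setRow-≡ Z r (Z s) j) (sym (setRow-≢ Z r (Z s) j (λ s≡r → r≢s (≡.sym s≡r)))))

    rowExpansion : ∀ r k (f : Fin k → Carrier) (U : Fin k → Fin n → Carrier) X →
                   (∀ j → X r j ≈ ∑ k (λ t → f t * U t j)) → D X ≈ ∑ k (λ t → f t * D (setRow X r (U t)))
    rowExpansion r zero    f U X Xᵣ≈ = zeroRow r X Xᵣ≈
    rowExpansion r (suc k) f U X Xᵣ≈ = begin
        D X
      ≈⟨ rowLinear r (f zero) 1# X (setRow X r (U zero)) (setRow X r V)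
           (λ j → trans (Xᵣ≈ j) (+-cong (*-cong refl (sym (setRow-≡ X r (U zero) j))) (sym (trans (*-identityˡ _) (setRow-≡ X r V j)))))
           (λ i i≢r j → sym (setRow-≢ X r (U zero) j i≢r) , sym (setRow-≢ X r V j i≢r)) ⟩
        f zero * D (setRow X r (U zero)) + 1# * D (setRow X r V)
      ≈⟨ +-cong refl (trans (*-identityˡ _) (rowExpansion r k (λ t → f (suc t)) (λ t → U (suc t)) (setRow X r V) (setRow-≡ X r V))) ⟩
        f zero * D (setRow X r (U zero)) + ∑ k (λ t → f (suc t) * D (setRow (setRow X r V) r (U (suc t))))
      ≈⟨ +-cong refl (∑-cong k (λ t → *-cong refl (cong (setRow-setRow X r V (U (suc t)))))) ⟩
        ∑ (suc k) (λ t → f t * D (setRow X r (U t))) ∎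
      where
      V : Fin n → Carrier
      V j = ∑ k (λ t → f (suc t) * U (suc t) j)
      setRow-setRow : ∀ X r u v i j → setRow (setRow X r u) r v i j ≈ setRow X r v i j
      setRow-setRow X r u v i j with i ≟ r
      ... | yes _ = refl
      ... | no _  = refl

  det-isAlternatingForm : ∀ n → IsAlternatingForm n (det R n)
  det-isAlternatingForm n = record { cong = det-cong n ; rowLinear = det-rowLinear n ; alternating = det-alternating n }

  insertZeroAt : ∀ {m} → Fin (suc m) → (Fin m → Carrier) → Fin (suc m) → Carrier
  insertZeroAt         zero    u zero    = 0#
  insertZeroAt         zero    u (suc k) = u k
  insertZeroAt {suc m} (suc j) u zero    = u zero
  insertZeroAt {suc m} (suc j) u (suc k) = insertZeroAt j (λ t → u (suc t)) k

  insertZeroAt-≡ : ∀ {m} (j : Fin (suc m)) u → insertZeroAt j u j ≡ 0#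
  insertZeroAt-≡         zero    u = ≡.refl
  insertZeroAt-≡ {suc m} (suc j) u = insertZeroAt-≡ j _

  insertZeroAt-punchIn : ∀ {m} (j : Fin (suc m)) u k → insertZeroAt j u (punchIn j k) ≡ u k
  insertZeroAt-punchIn         zero    u k       = ≡.refl
  insertZeroAt-punchIn {suc m} (suc j) u zero    = ≡.refl
  insertZeroAt-punchIn {suc m} (suc j) u (suc k) = insertZeroAt-punchIn j _ k

  insertZeroAt-cong : ∀ {m} (j : Fin (suc m)) {u v} → (∀ k → u k ≈ v k) → ∀ t → insertZeroAt j u t ≈ insertZeroAt j v t
  insertZeroAt-cong j {u} {v} u≈v = punchIn-elim j (λ t → insertZeroAt j u t ≈ insertZeroAt j v t)
    (reflexive (≡.trans (insertZeroAt-≡ j u) (≡.sym (insertZeroAt-≡ j v))))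
    (λ k → trans (reflexive (insertZeroAt-punchIn j u k)) (trans (u≈v k) (reflexive (≡.sym (insertZeroAt-punchIn j v k)))))

  insertZeroAt-δ : ∀ {m} (j : Fin (suc m)) (i : Fin m) t → insertZeroAt j (δ i) t ≈ δ (punchIn j i) t
  insertZeroAt-δ j i = punchIn-elim j (λ t → insertZeroAt j (δ i) t ≈ δ (punchIn j i) t)
    (trans (reflexive (insertZeroAt-≡ j (δ i))) (sym (δ-≢ (FinP.punchInᵢ≢i j i))))
    (λ k → trans (reflexive (insertZeroAt-punchIn j (δ i) k)) (punched k))
    where
    punched : ∀ k → δ i k ≈ δ (punchIn j i) (punchIn j k)
    punched k with i ≟ k
    ... | yes ≡.refl = sym (δ-refl (punchIn j k))
    ... | no i≢k     = sym (δ-≢ (λ eq → i≢k (FinP.punchIn-injective j i k eq)))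

  -- Expand D along row 0. Row operations against row 0 = δ j clear column j, so D (setRow X zero (δ j))
  -- is an alternating form E j of the minor; by induction it is det (minor j X) * E j 1ᴹ, and E j 1ᴹ = ±D 1ᴹ.
  module Uniqueness {m} {D : Matrix (suc m) → Carrier} (form : IsAlternatingForm (suc m) D)
    (unique : ∀ {E} → IsAlternatingForm m E → ∀ W → E W ≈ det R m W * E 1ᴹ) where
    open IsAlternatingForm form

    addMultiplesOfRow₀ : (Fin m → Carrier) → Matrix (suc m) → ℕ → Matrix (suc m)
    addMultiplesOfRow₀ a Z k zero    j = Z zero j
    addMultiplesOfRow₀ a Z k (suc i) j = if does (toℕ i ℕ.<? k) then Z (suc i) j + a i * Z zero j else Z (suc i) j

    addMultiplesOfRow₀-invariant : ∀ a Z k → k ℕ.≤ m → D (addMultiplesOfRow₀ a Z k) ≈ D Z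
    addMultiplesOfRow₀-invariant a Z zero    _   = cong (λ { zero j → refl ; (suc i) j → refl })
    addMultiplesOfRow₀-invariant a Z (suc k) k<m =
      trans (addRowMultiple {suc i₀} {zero} (λ ()) (a i₀) _ _ newRow others) (addMultiplesOfRow₀-invariant a Z k (ℕP.<⇒≤ k<m))
      where
      i₀ : Fin m
      i₀ = fromℕ< k<m
      i₀≡k : toℕ i₀ ≡ k
      i₀≡k = FinP.toℕ-fromℕ< k<m
      newRow : ∀ j → addMultiplesOfRow₀ a Z (suc k) (suc i₀) j ≈ addMultiplesOfRow₀ a Z k (suc i₀) j + a i₀ * Z zero j
      newRow j rewrite i₀≡k | dec-true (k ℕ.<? suc k) (ℕP.n<1+n k) | dec-false (k ℕ.<? k) (ℕP.<-irrefl ≡.refl) = refl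
      sameDecision : ∀ x → x ≢ k → does (x ℕ.<? suc k) ≡ does (x ℕ.<? k)
      sameDecision x x≢k with ℕP.<-cmp x k
      ... | tri< x<k _ _ = ≡.trans (dec-true (x ℕ.<? suc k) (ℕP.m<n⇒m<1+n x<k)) (≡.sym (dec-true (x ℕ.<? k) x<k))
      ... | tri≈ _ x≡k _ = ⊥-elim (x≢k x≡k)
      ... | tri> _ _ k<x = ≡.trans (dec-false (x ℕ.<? suc k) (λ x<1+k → ℕP.<⇒≱ k<x (ℕP.≤-pred x<1+k)))
                                   (≡.sym (dec-false (x ℕ.<? k) (ℕP.<-asym k<x)))
      others : ∀ i → i ≢ suc i₀ → ∀ j → addMultiplesOfRow₀ a Z (suc k) i j ≈ addMultiplesOfRow₀ a Z k i j
      others zero    _        j = refl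
      others (suc i) i≢i₀ j = reflexive (≡.cong (λ b → if b then Z (suc i) j + a i * Z zero j else Z (suc i) j)
        (sameDecision (toℕ i) (λ i≡k → i≢i₀ (≡.cong suc (FinP.toℕ-injective (≡.trans i≡k (≡.sym i₀≡k)))))))

    withRow₀ : Fin (suc m) → Matrix m → Matrix (suc m)
    withRow₀ j W zero    = δ j
    withRow₀ j W (suc i) = insertZeroAt j (W i)

    E : Fin (suc m) → Matrix m → Carrier
    E j W = D (withRow₀ j W)

    E-isAlternatingForm : ∀ j → IsAlternatingForm m (E j)
    E-isAlternatingForm j = record
      { cong        = λ W≈ → cong (λ { zero t → refl ; (suc i) t → insertZeroAt-cong j (W≈ i) t })
      ; rowLinear   = λ r a b X Y Z Xᵣ≈ others → rowLinear (suc r) a b _ _ _ (newRow r a b X Y Z Xᵣ≈)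
          (λ { zero _ t → refl , refl
             ; (suc i) i≢r t → insertZeroAt-cong j (λ k → proj₁ (others i (λ eq → i≢r (≡.cong suc eq)) k)) t
                             , insertZeroAt-cong j (λ k → proj₂ (others i (λ eq → i≢r (≡.cong suc eq)) k)) t })
      ; alternating = λ p≢q W rows≈ → alternating (λ eq → p≢q (FinP.suc-injective eq)) (withRow₀ j W) (insertZeroAt-cong j rows≈)
      }
      where
      newRow : ∀ r a b (X Y Z : Matrix m) → (∀ k → X r k ≈ a * Y r k + b * Z r k) →
               ∀ t → insertZeroAt j (X r) t ≈ a * insertZeroAt j (Y r) t + b * insertZeroAt j (Z r) t
      newRow r a b X Y Z Xᵣ≈ = punchIn-elim j (λ t → insertZeroAt j (X r) t ≈ a * insertZeroAt j (Y r) t + b * insertZeroAt j (Z r) t)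
        (begin
          insertZeroAt j (X r) j                                       ≡⟨ insertZeroAt-≡ j (X r) ⟩
          0#                                                           ≈⟨ +-identityʳ 0# ⟨
          0# + 0#                                                      ≈⟨ +-cong (zeroʳ a) (zeroʳ b) ⟨
          a * 0# + b * 0#
            ≡⟨ ≡.cong₂ (λ y z → a * y + b * z) (insertZeroAt-≡ j (Y r)) (insertZeroAt-≡ j (Z r)) ⟨
          a * insertZeroAt j (Y r) j + b * insertZeroAt j (Z r) j      ∎)
        (λ k → begin
          insertZeroAt j (X r) (punchIn j k)                           ≡⟨ insertZeroAt-punchIn j (X r) k ⟩
          X r k                                                        ≈⟨ Xᵣ≈ k ⟩
          a * Y r k + b * Z r k
            ≡⟨ ≡.cong₂ (λ y z → a * y + b * z) (insertZeroAt-punchIn j (Y r) k) (insertZeroAt-punchIn j (Z r) k) ⟨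
          a * insertZeroAt j (Y r) (punchIn j k) + b * insertZeroAt j (Z r) (punchIn j k) ∎)

    E-minor : ∀ (X : Matrix (suc m)) j → E j (minor j X) ≈ D (setRow X zero (δ j))
    E-minor X j = trans (cong entries) (addMultiplesOfRow₀-invariant a (setRow X zero (δ j)) m ℕP.≤-refl)
      where
      a : Fin m → Carrier
      a i = - X (suc i) j
      entries : ∀ i t → withRow₀ j (minor j X) i t ≈ addMultiplesOfRow₀ a (setRow X zero (δ j)) m i t
      entries zero    t = refl
      entries (suc i) t rewrite dec-true (toℕ i ℕ.<? m) (FinP.toℕ<n i) =
        punchIn-elim j (λ t → insertZeroAt j (minor j X i) t ≈ X (suc i) t + a i * δ j t)
          (begin
            insertZeroAt j (minor j X i) j     ≡⟨ insertZeroAt-≡ j (minor j X i) ⟩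
            0#                                 ≈⟨ -‿inverseʳ _ ⟨
            X (suc i) j + a i                  ≈⟨ +-cong refl (trans (*-cong refl (δ-refl j)) (*-identityʳ _)) ⟨
            X (suc i) j + a i * δ j j          ∎)
          (λ k → begin
            insertZeroAt j (minor j X i) (punchIn j k)  ≡⟨ insertZeroAt-punchIn j (minor j X i) k ⟩
            X (suc i) (punchIn j k)                     ≈⟨ +-identityʳ _ ⟨
            X (suc i) (punchIn j k) + 0#
              ≈⟨ +-cong refl (trans (*-cong refl (δ-≢ (λ j≡ → FinP.punchInᵢ≢i j k (≡.sym j≡)))) (zeroʳ _)) ⟨
            X (suc i) (punchIn j k) + a i * δ j (punchIn j k) ∎)
          t

    E-identity : ∀ k (j : Fin (suc m)) → toℕ j ≡ k → E j 1ᴹ ≈ sgn R k * D 1ᴹ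
    E-identity zero    zero    _  = trans (cong (λ { zero t → refl ; (suc i) t → insertZeroAt-δ zero i t })) (sym (*-identityˡ _))
    E-identity (suc k) (suc c) j≡ = begin
        D (withRow₀ (suc c) 1ᴹ)                    ≈⟨ cong entries ⟩
        D (swapRows zero (suc c) B)                ≈⟨ swapRows-negates D cong rowLinear (λ ()) (alternating (λ ())) B ⟩
        - D B                                      ≈⟨ -‿cong (E-identity k (inject₁ c) (≡.trans (FinP.toℕ-inject₁ c) (ℕP.suc-injective j≡))) ⟩
        - (sgn R k * D 1ᴹ)                         ≈⟨ -‿distribˡ-* _ _ ⟩
        sgn R (suc k) * D 1ᴹ                       ∎
      where
      B : Matrix (suc m)
      B = withRow₀ (inject₁ c) 1ᴹ
      entries : ∀ i t → withRow₀ (suc c) 1ᴹ i t ≈ swapRows zero (suc c) B i t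
      entries zero    t = sym (trans (insertZeroAt-δ (inject₁ c) c t) (reflexive (≡.cong (λ u → δ u t) (punchIn-inject₁-self c))))
      entries (suc i) t with i ≟ c
      ... | yes ≡.refl = trans (insertZeroAt-δ (suc i) i t) (reflexive (≡.cong (λ u → δ u t) (punchIn-suc-self i)))
      ... | no i≢c     = trans (insertZeroAt-δ (suc c) i t)
          (sym (trans (insertZeroAt-δ (inject₁ c) i t) (reflexive (≡.cong (λ u → δ u t) (sameColumn (punchIn-adjacent c i))))))
        where
        sameColumn : punchIn (inject₁ c) i ≡ punchIn (suc c) i ⊎ (punchIn (inject₁ c) i ≡ suc c × punchIn (suc c) i ≡ inject₁ c) →
                     punchIn (inject₁ c) i ≡ punchIn (suc c) i
        sameColumn (inj₁ eq)     = eq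
        sameColumn (inj₂ (eq , _)) = ⊥-elim (i≢c (FinP.punchIn-injective (inject₁ c) i c (≡.trans eq (≡.sym (punchIn-inject₁-self c)))))

    unique-suc : ∀ X → D X ≈ det R (suc m) X * D 1ᴹ
    unique-suc X = begin
        D X
      ≈⟨ rowExpansion zero (suc m) (X zero) δ X (λ j → sym (∑-δ (suc m) (X zero) j)) ⟩
        ∑ (suc m) (λ j → X zero j * D (setRow X zero (δ j)))
      ≈⟨ ∑-cong (suc m) {λ j → X zero j * D (setRow X zero (δ j))} (λ j → *-cong refl (trans (sym (E-minor X j))
           (trans (unique (E-isAlternatingForm j) (minor j X)) (*-cong refl (E-identity (toℕ j) j ≡.refl))))) ⟩
        ∑ (suc m) (λ j → X zero j * (det R m (minor j X) * (sgn R (toℕ j) * D 1ᴹ)))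
      ≈⟨ ∑-cong (suc m) {λ j → X zero j * (det R m (minor j X) * (sgn R (toℕ j) * D 1ᴹ))} (λ j →
           solve 4 (λ x d s e → x :* (d :* (s :* e)) := (s :* (x :* d)) :* e) refl (X zero j) (det R m (minor j X)) (sgn R (toℕ j)) (D 1ᴹ)) ⟩
        ∑ (suc m) (λ j → laplaceTerm X j * D 1ᴹ)
      ≈⟨ *-distribʳ-∑ (suc m) (D 1ᴹ) (laplaceTerm X) ⟨
        det R (suc m) X * D 1ᴹ ∎

  alternatingForm-unique : ∀ n {D} → IsAlternatingForm n D → ∀ X → D X ≈ det R n X * D 1ᴹ
  alternatingForm-unique zero    form X = trans (IsAlternatingForm.cong form (λ ())) (sym (*-identityˡ _))
  alternatingForm-unique (suc m) form   = Uniqueness.unique-suc form (alternatingForm-unique m)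

  _*ᴹ_ : ∀ {n} → Matrix n → Matrix n → Matrix n
  _*ᴹ_ {n} A B i j = ∑ n (λ k → A i k * B k j)

  *ᴹ-identityˡ : ∀ n (B : Matrix n) i j → (1ᴹ *ᴹ B) i j ≈ B i j
  *ᴹ-identityˡ n B i j = trans (∑-cong n (λ k → trans (*-comm _ _) (*-cong refl (δ-sym i k)))) (∑-δ n (λ k → B k j) i)

  det-* : ∀ n (A B : Matrix n) → det R n (A *ᴹ B) ≈ det R n A * det R n B
  det-* n A B = trans (alternatingForm-unique n form A) (*-cong refl (det-cong n (*ᴹ-identityˡ n B)))
    where
    open IsAlternatingForm (det-isAlternatingForm n)
    form : IsAlternatingForm n (λ X → det R n (X *ᴹ B))
    form = record
      { cong        = λ X≈Y → cong (λ i j → ∑-cong n (λ k → *-cong (X≈Y i k) refl))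
      ; rowLinear   = λ r a b X Y Z Xᵣ≈ others → rowLinear r a b (X *ᴹ B) (Y *ᴹ B) (Z *ᴹ B)
          (λ j → trans (∑-cong n (λ k → trans (*-cong (Xᵣ≈ k) refl) (trans (distribʳ _ _ _) (+-cong (*-assoc _ _ _) (*-assoc _ _ _)))))
                       (∑-linear n a b _ _))
          (λ i i≢r j → ∑-cong n (λ k → *-cong (proj₁ (others i i≢r k)) refl) , ∑-cong n (λ k → *-cong (proj₂ (others i i≢r k)) refl))
      ; alternating = λ p≢q X rows≈ → alternating p≢q (X *ᴹ B) (λ j → ∑-cong n (λ k → *-cong (rows≈ k) refl))
      }

  ∏ : (n : ℕ) → (Fin n → Carrier) → Carrier
  ∏ zero    f = 1#
  ∏ (suc n) f = f zero * ∏ n (λ i → f (suc i))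

  ∏-cong : ∀ n {f g : Fin n → Carrier} → (∀ i → f i ≈ g i) → ∏ n f ≈ ∏ n g
  ∏-cong zero    f≈g = refl
  ∏-cong (suc n) f≈g = *-cong (f≈g zero) (∏-cong n (λ i → f≈g (suc i)))

  ∏-one : ∀ n {f : Fin n → Carrier} → (∀ i → f i ≈ 1#) → ∏ n f ≈ 1#
  ∏-one zero    f≈1 = refl
  ∏-one (suc n) f≈1 = trans (*-cong (f≈1 zero) (∏-one n (λ i → f≈1 (suc i)))) (*-identityˡ _)

  ∏-last : ∀ n (f : Fin (suc n) → Carrier) → ∏ (suc n) f ≈ ∏ n (λ i → f (inject₁ i)) * f (fromℕ n)
  ∏-last zero    f = trans (*-identityʳ _) (sym (*-identityˡ _))
  ∏-last (suc n) f = trans (*-cong refl (∏-last n (λ i → f (suc i)))) (sym (*-assoc _ _ _))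

  det-lowerTriangular : ∀ n (X : Matrix n) → (∀ i j → toℕ i ℕ.< toℕ j → X i j ≈ 0#) → det R n X ≈ ∏ n (λ i → X i i)
  det-lowerTriangular zero    X upper≈0 = refl
  det-lowerTriangular (suc n) X upper≈0 = begin
      laplaceTerm X zero + ∑ n (λ j → laplaceTerm X (suc j))
    ≈⟨ +-cong (*-identityˡ _) (∑-zero n (λ j → trans (*-cong refl (trans (*-cong (upper≈0 zero (suc j) (s≤s z≤n)) refl) (zeroˡ _))) (zeroʳ _))) ⟩
      X zero zero * det R n (minor zero X) + 0#
    ≈⟨ +-identityʳ _ ⟩
      X zero zero * det R n (λ a b → X (suc a) (suc b))
    ≈⟨ *-cong refl (det-lowerTriangular n (λ a b → X (suc a) (suc b)) (λ i j i<j → upper≈0 (suc i) (suc j) (s≤s i<j))) ⟩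
      ∏ (suc n) (λ i → X i i) ∎

  topLeft : ∀ {n} → Matrix (suc n) → Matrix n
  topLeft X a b = X (inject₁ a) (inject₁ b)

  det-lastRow : ∀ n (X : Matrix (suc n)) → (∀ j → X (fromℕ n) (inject₁ j) ≈ 0#) →
                det R (suc n) X ≈ X (fromℕ n) (fromℕ n) * det R n (topLeft X)
  det-lastRow zero    X _        = trans (+-identityʳ _) (*-identityˡ _)
  det-lastRow (suc m) X lastRow≈ = begin
      det R (suc (suc m)) X
    ≈⟨ ∑-last (suc m) (laplaceTerm X) ⟩
      ∑ (suc m) (λ j → laplaceTerm X (inject₁ j)) + laplaceTerm X (fromℕ (suc m))
    ≈⟨ +-cong (∑-cong (suc m) {λ j → laplaceTerm X (inject₁ j)} term) (trans (*-cong refl (trans (*-cong refl lastMinor≈0) (zeroʳ _))) (zeroʳ _)) ⟩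
      ∑ (suc m) (λ j → x * laplaceTerm (topLeft X) j) + 0#
    ≈⟨ trans (+-identityʳ _) (sym (*-distribˡ-∑ (suc m) x (laplaceTerm (topLeft X)))) ⟩
      x * det R (suc m) (topLeft X) ∎
    where
    x : Carrier
    x = X (fromℕ (suc m)) (fromℕ (suc m))
    lastMinor≈0 : det R (suc m) (minor (fromℕ (suc m)) X) ≈ 0#
    lastMinor≈0 = IsAlternatingForm.zeroRow (det-isAlternatingForm (suc m)) (fromℕ m) (minor (fromℕ (suc m)) X)
      (λ k → trans (reflexive (≡.cong (X (fromℕ (suc m))) (punchIn-last k))) (lastRow≈ _))
    term : ∀ j → laplaceTerm X (inject₁ j) ≈ x * laplaceTerm (topLeft X) j
    term j = begin
        sgn R (toℕ (inject₁ j)) * (X zero (inject₁ j) * det R (suc m) (minor (inject₁ j) X))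
      ≈⟨ *-cong (reflexive (≡.cong (sgn R) (FinP.toℕ-inject₁ j)))
                (*-cong refl (det-lastRow m (minor (inject₁ j) X)
                   (λ k → trans (reflexive (≡.cong (X (fromℕ (suc m))) (punchIn-inject₁ j k))) (lastRow≈ _)))) ⟩
        sgn R (toℕ j) * (X zero (inject₁ j) * (minor (inject₁ j) X (fromℕ m) (fromℕ m) * det R m (topLeft (minor (inject₁ j) X))))
      ≈⟨ *-cong refl (*-cong refl (*-cong (reflexive (≡.cong (X (fromℕ (suc m))) (punchIn-inject₁-last j)))
                                           (det-cong m (λ a b → reflexive (≡.cong (X (suc (inject₁ a))) (punchIn-inject₁ j b)))))) ⟩
        sgn R (toℕ j) * (X zero (inject₁ j) * (x * det R m (minor j (topLeft X))))
      ≈⟨ solve 4 (λ s a x d → s :* (a :* (x :* d)) := x :* (s :* (a :* d))) refl _ _ _ _ ⟩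
        x * laplaceTerm (topLeft X) j ∎

  det-lastColumn : ∀ n (X : Matrix (suc n)) → (∀ i → X (inject₁ i) (fromℕ n) ≈ 0#) →
                   det R (suc n) X ≈ X (fromℕ n) (fromℕ n) * det R n (topLeft X)
  det-lastColumn n X lastColumn≈ =
    trans (sym (det-transpose (suc n) X)) (trans (det-lastRow n (X ᵀ) lastColumn≈) (*-cong refl (det-transpose n (topLeft X))))

  det-lastRowUnit : ∀ n (A : Matrix (suc n)) → det R (suc n) (setRow A (fromℕ n) (δ (fromℕ n))) ≈ det R n (topLeft A)
  det-lastRowUnit n A = begin
      det R (suc n) V
    ≈⟨ det-lastRow n V (λ j → trans (setRow-≡ A L (δ L) (inject₁ j)) (δ-≢ (FinP.fromℕ≢inject₁ {i = j}))) ⟩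
      V L L * det R n (topLeft V)
    ≈⟨ *-cong (trans (setRow-≡ A L (δ L) L) (δ-refl L))
              (det-cong n (λ a b → setRow-≢ A L (δ L) (inject₁ b) (λ eq → FinP.fromℕ≢inject₁ (≡.sym eq)))) ⟩
      1# * det R n (topLeft A)
    ≈⟨ *-identityˡ _ ⟩
      det R n (topLeft A) ∎
    where
    L : Fin (suc n)
    L = fromℕ n
    V : Matrix (suc n)
    V = setRow A L (δ L)

  det-cornerUpdate : ∀ n (M A : Matrix (suc n)) x →
    (∀ i j → i ≢ fromℕ n → M i j ≈ A i j) → (∀ j → M (fromℕ n) j ≈ A (fromℕ n) j + x * δ (fromℕ n) j) →
    det R (suc n) M ≈ det R (suc n) A + x * det R n (topLeft A)
  det-cornerUpdate n M A x others lastRow =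
    trans (det-rowLinear (suc n) L 1# x M A (setRow A L (δ L))
            (λ j → trans (lastRow j) (+-cong (sym (*-identityˡ _)) (*-cong refl (sym (setRow-≡ A L (δ L) j)))))
            (λ i i≢L j → others i j i≢L , trans (others i j i≢L) (sym (setRow-≢ A L (δ L) j i≢L))))
          (+-cong (*-identityˡ _) (*-cong refl (det-lastRowUnit n A)))
    where
    L : Fin (suc n)
    L = fromℕ n

  module Tridiagonal (d u l : ℕ → Carrier) where

    tridiagonal : ℕ → ℕ → Carrier
    tridiagonal i j = δℕ i j * d i + δℕ (suc i) j * u i + δℕ i (suc j) * l i

    Tri : ∀ n → Matrix n
    Tri n i j = tridiagonal (toℕ i) (toℕ j)

    continuant : ℕ → Carrier
    continuant n = det R n (Tri n)

    tridiagonal-far : ∀ {i j} → i ≢ j → suc i ≢ j → i ≢ suc j → tridiagonal i j ≈ 0#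
    tridiagonal-far {i} {j} i≢j i+1≢j i≢j+1 = begin
      δℕ i j * d i + δℕ (suc i) j * u i + δℕ i (suc j) * l i
        ≈⟨ +-cong (+-cong (*-cong (δℕ-≢ i≢j) refl) (*-cong (δℕ-≢ i+1≢j) refl)) (*-cong (δℕ-≢ i≢j+1) refl) ⟩
      0# * d i + 0# * u i + 0# * l i                          ≈⟨ +-cong (+-cong (zeroˡ _) (zeroˡ _)) (zeroˡ _) ⟩
      0# + 0# + 0#                                            ≈⟨ trans (+-identityʳ _) (+-identityʳ _) ⟩
      0#                                                      ∎

    tridiagonal-super : ∀ i → tridiagonal i (suc i) ≈ u i
    tridiagonal-super i = begin
      δℕ i (suc i) * d i + δℕ (suc i) (suc i) * u i + δℕ i (suc (suc i)) * l i
        ≈⟨ +-cong (+-cong (*-cong (δℕ-≢ (ℕP.<⇒≢ (ℕP.n<1+n i))) refl) (*-cong (δℕ-refl i) refl))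
                  (*-cong (δℕ-≢ (ℕP.<⇒≢ (ℕP.<-trans (ℕP.n<1+n i) (ℕP.n<1+n (suc i))))) refl) ⟩
      0# * d i + 1# * u i + 0# * l i
        ≈⟨ solve 3 (λ d u l → con 0 :* d :+ con 1 :* u :+ con 0 :* l := u) refl (d i) (u i) (l i) ⟩
      u i ∎

    tridiagonal-lastRow : ∀ n j → j ℕ.≤ suc n → tridiagonal (suc n) j ≈ d (suc n) * δℕ (suc n) j + l (suc n) * δℕ n j
    tridiagonal-lastRow n j j≤n+1 = begin
      δℕ (suc n) j * d (suc n) + δℕ (suc (suc n)) j * u (suc n) + δℕ (suc n) (suc j) * l (suc n)
        ≈⟨ +-cong (+-cong refl (trans (*-cong (δℕ-≢ (λ eq → ℕP.<⇒≱ (s≤s ℕP.≤-refl) (≡.subst (ℕ._≤ suc n) (≡.sym eq) j≤n+1))) refl)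
                                      (zeroˡ _))) refl ⟩
      δℕ (suc n) j * d (suc n) + 0# + δℕ n j * l (suc n)
        ≈⟨ +-cong (trans (+-identityʳ _) (*-comm _ _)) (*-comm _ _) ⟩
      d (suc n) * δℕ (suc n) j + l (suc n) * δℕ n j ∎

    topLeft-Tri : ∀ n a b → topLeft (Tri (suc n)) a b ≈ Tri n a b
    topLeft-Tri n a b = reflexive (≡.cong₂ tridiagonal (FinP.toℕ-inject₁ a) (FinP.toℕ-inject₁ b))

    module LastRows (n : ℕ) where

      N : ℕ
      N = suc (suc n)

      L L′ : Fin N
      L  = fromℕ (suc n)
      L′ = inject₁ (fromℕ n)

      toℕL : toℕ L ≡ suc n
      toℕL = FinP.toℕ-fromℕ (suc n)

      toℕL′ : toℕ L′ ≡ n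
      toℕL′ = ≡.trans (FinP.toℕ-inject₁ (fromℕ n)) (FinP.toℕ-fromℕ n)

      L′≢L : L′ ≢ L
      L′≢L eq = FinP.fromℕ≢inject₁ (≡.sym eq)

      Tri-lastRow : ∀ j → Tri N L j ≈ d (suc n) * δ L j + l (suc n) * δ L′ j
      Tri-lastRow j = begin
          tridiagonal (toℕ L) (toℕ j)
        ≡⟨ ≡.cong (λ x → tridiagonal x (toℕ j)) toℕL ⟩
          tridiagonal (suc n) (toℕ j)
        ≈⟨ tridiagonal-lastRow n (toℕ j) (ℕP.≤-pred (FinP.toℕ<n j)) ⟩
          d (suc n) * δℕ (suc n) (toℕ j) + l (suc n) * δℕ n (toℕ j)
        ≈⟨ +-cong (*-cong refl (trans (reflexive (≡.cong (λ x → δℕ x (toℕ j)) (≡.sym toℕL))) (sym (δ≈δℕ L j))))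
                  (*-cong refl (trans (reflexive (≡.cong (λ x → δℕ x (toℕ j)) (≡.sym toℕL′))) (sym (δ≈δℕ L′ j)))) ⟩
          d (suc n) * δ L j + l (suc n) * δ L′ j ∎

      X₂ : Matrix N
      X₂ = setRow (Tri N) L (δ L′)

      Z : Matrix N
      Z = swapRows L′ L X₂

      Z-L′ : ∀ j → Z L′ j ≈ δ L′ j
      Z-L′ j = trans (setRow-≡ (setRow X₂ L (X₂ L′)) L′ (X₂ L) j) (setRow-≡ (Tri N) L (δ L′) j)

      Z-L : ∀ j → Z L j ≈ Tri N L′ j
      Z-L j = trans (setRow-≢ (setRow X₂ L (X₂ L′)) L′ (X₂ L) j (λ eq → L′≢L (≡.sym eq)))
                (trans (setRow-≡ X₂ L (X₂ L′) j) (setRow-≢ (Tri N) L (δ L′) j L′≢L))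

      Z-other : ∀ {i} j → i ≢ L′ → i ≢ L → Z i j ≈ Tri N i j
      Z-other j i≢L′ i≢L = trans (setRow-≢ (setRow X₂ L (X₂ L′)) L′ (X₂ L) j i≢L′)
                             (trans (setRow-≢ X₂ L (X₂ L′) j i≢L) (setRow-≢ (Tri N) L (δ L′) j i≢L))

      Z-lastColumn : ∀ i → Z (inject₁ i) L ≈ 0#
      Z-lastColumn i = entry (inject₁ i ≟ L′)
        where
        i<n+1 : toℕ (inject₁ i) ℕ.< toℕ L
        i<n+1 = ≡.subst₂ ℕ._<_ (≡.sym (FinP.toℕ-inject₁ i)) (≡.sym toℕL) (FinP.toℕ<n i)
        entry : Dec (inject₁ i ≡ L′) → Z (inject₁ i) L ≈ 0#
        entry (yes i≡L′) = trans (reflexive (≡.cong (λ r → Z r L) i≡L′)) (trans (Z-L′ L) (δ-≢ L′≢L))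
        entry (no i≢L′)  = trans (Z-other L i≢L′ (λ eq → FinP.fromℕ≢inject₁ (≡.sym eq)))
          (tridiagonal-far (λ eq → ℕP.<-irrefl eq i<n+1)
                           (λ eq → i≢L′ (FinP.toℕ-injective (≡.trans (ℕP.suc-injective eq) (≡.trans (FinP.toℕ-fromℕ n) (≡.sym toℕL′)))))
                           (λ eq → ℕP.<-irrefl eq (ℕP.<-trans i<n+1 (ℕP.n<1+n (toℕ L)))))

      det-topLeft-Z : det R (suc n) (topLeft Z) ≈ continuant n
      det-topLeft-Z = begin
          det R (suc n) (topLeft Z)
        ≈⟨ det-lastRow n (topLeft Z) (λ j → trans (Z-L′ _) (trans (δ≈δℕ L′ _)
             (δℕ-≢ (λ eq → ℕP.<-irrefl (≡.trans (≡.sym (toℕ-inject₁² j)) (≡.trans (≡.sym eq) toℕL′)) (FinP.toℕ<n j))))) ⟩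
          Z L′ L′ * det R n (topLeft (topLeft Z))
        ≈⟨ *-cong (trans (Z-L′ L′) (δ-refl L′))
                  (det-cong n (λ a b → trans (Z-other _ (below a) (λ eq → FinP.fromℕ≢inject₁ (≡.sym eq)))
                                             (reflexive (≡.cong₂ tridiagonal (toℕ-inject₁² a) (toℕ-inject₁² b))))) ⟩
          1# * continuant n
        ≈⟨ *-identityˡ _ ⟩
          continuant n ∎
        where
        toℕ-inject₁² : ∀ {k} (a : Fin k) → toℕ (inject₁ (inject₁ a)) ≡ toℕ a
        toℕ-inject₁² a = ≡.trans (FinP.toℕ-inject₁ (inject₁ a)) (FinP.toℕ-inject₁ a)
        below : ∀ (a : Fin n) → inject₁ (inject₁ a) ≢ L′
        below a eq = ℕP.<-irrefl (≡.trans (≡.sym (toℕ-inject₁² a)) (≡.trans (≡.cong toℕ eq) toℕL′)) (FinP.toℕ<n a)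

      det-X₂ : det R N X₂ ≈ - (u n * continuant n)
      det-X₂ = begin
        det R N X₂                          ≈⟨ -‿involutive _ ⟨
        - - det R N X₂                      ≈⟨ -‿cong (det-swapRows N L′≢L X₂) ⟨
        - det R N Z                         ≈⟨ -‿cong (det-lastColumn (suc n) Z Z-lastColumn) ⟩
        - (Z L L * det R (suc n) (topLeft Z))
          ≈⟨ -‿cong (*-cong (trans (Z-L L) (trans (reflexive (≡.cong₂ tridiagonal toℕL′ toℕL)) (tridiagonal-super n))) det-topLeft-Z) ⟩
        - (u n * continuant n)              ∎

    -- Split the last row, d (n+1) δ (n+1) + l (n+1) δ n, by linearity. In the δ n part, swapping the last
    -- two rows leaves u n as the only entry of the last column.
    continuant-rec : ∀ n → continuant (suc (suc n)) ≈ d (suc n) * continuant (suc n) - (u n * l (suc n)) * continuant n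
    continuant-rec n = begin
        det R N (Tri N)
      ≈⟨ det-rowLinear N L (d (suc n)) (l (suc n)) (Tri N) (setRow (Tri N) L (δ L)) X₂
           (λ j → trans (Tri-lastRow j) (sym (+-cong (*-cong refl (setRow-≡ (Tri N) L (δ L) j)) (*-cong refl (setRow-≡ (Tri N) L (δ L′) j)))))
           (λ i i≢L j → sym (setRow-≢ (Tri N) L (δ L) j i≢L) , sym (setRow-≢ (Tri N) L (δ L′) j i≢L)) ⟩
        d (suc n) * det R N (setRow (Tri N) L (δ L)) + l (suc n) * det R N X₂
      ≈⟨ +-cong (*-cong refl (trans (det-lastRowUnit (suc n) (Tri N)) (det-cong (suc n) (topLeft-Tri (suc n))))) (*-cong refl det-X₂) ⟩
        d (suc n) * continuant (suc n) + l (suc n) * - (u n * continuant n)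
      ≈⟨ +-cong refl (trans (sym (-‿distribʳ-* _ _))
           (-‿cong (solve 3 (λ l u g → l :* (u :* g) := (u :* l) :* g) refl (l (suc n)) (u n) (continuant n)))) ⟩
        d (suc n) * continuant (suc n) - (u n * l (suc n)) * continuant n ∎
      where open LastRows n

    continuant-one : continuant 1 ≈ d 0
    continuant-one = solve 3 (λ d u l → con 1 :* ((con 1 :* d :+ con 0 :* u :+ con 0 :* l) :* con 1) :+ con 0 := d) refl (d 0) (u 0) (l 0)

    continuant-unique : (g : ℕ → Carrier) → g 0 ≈ 1# → g 1 ≈ d 0 →
      (∀ n → g (suc (suc n)) ≈ d (suc n) * g (suc n) - (u n * l (suc n)) * g n) → ∀ n → continuant n ≈ g n
    continuant-unique g g₀ g₁ g-rec n = proj₁ (consecutive n)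
      where
      consecutive : ∀ n → continuant n ≈ g n × continuant (suc n) ≈ g (suc n)
      consecutive zero    = sym g₀ , trans continuant-one (sym g₁)
      consecutive (suc n) with consecutive n
      ... | Gₙ≈ , Gₙ₊₁≈ =
        Gₙ₊₁≈ , trans (continuant-rec n) (trans (+-cong (*-cong refl Gₙ₊₁≈) (-‿cong (*-cong refl Gₙ≈))) (sym (g-rec n)))

module LatticePaths {c ℓ : Level} (R : CommutativeRing c ℓ) (T : ℕ → CommutativeRing.Carrier R) where

  open CommutativeRing R hiding (zero)
  open LinearAlgebra R using (∑ℕ; ∑ℕ-cong; ∑ℕ-zero; ∑ℕ-+; ∑ℕ-last)
  open SemiringSolver commutativeSemiring using (solve; _:+_; _:*_; _:=_; con)
  open SetoidReasoning setoid

  C : ℕ → ℕ → Carrier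
  C = cnk R T

  π : ℕ → Carrier
  π = prodT R T 0

  C-above : ∀ {m h} → m ℕ.< h → C m h ≈ 0#
  C-above {zero}  {suc h} _         = refl
  C-above {suc m} {suc h} (s≤s m<h) =
    trans (+-cong (C-above m<h) (trans (*-cong refl (C-above (ℕP.<-trans m<h (ℕP.<-trans (ℕP.n<1+n h) (ℕP.n<1+n (suc h)))))) (zeroʳ _)))
          (+-identityʳ _)

  C-diagonal : ∀ m → C m m ≈ 1#
  C-diagonal zero    = refl
  C-diagonal (suc m) = trans (+-cong (C-diagonal m) (trans (*-cong refl (C-above (ℕP.<-trans (ℕP.n<1+n m) (ℕP.n<1+n (suc m))))) (zeroʳ _)))
                             (+-identityʳ _)

  C-even-odd : ∀ i k → C (double i) (suc (double k)) ≈ 0#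
  C-odd-even : ∀ i k → C (suc (double i)) (double k) ≈ 0#
  C-even-odd zero    k = refl
  C-even-odd (suc i) k = trans (+-cong (C-odd-even i k) (trans (*-cong refl (C-odd-even i (suc k))) (zeroʳ _))) (+-identityʳ _)
  C-odd-even i zero    = trans (*-cong refl (C-even-odd i 0)) (zeroʳ _)
  C-odd-even i (suc k) = trans (+-cong (C-even-odd i k) (trans (*-cong refl (C-even-odd i (suc k))) (zeroʳ _))) (+-identityʳ _)

  shiftDown : (ℕ → Carrier) → ℕ → Carrier
  shiftDown F zero    = 0#
  shiftDown F (suc h) = F h

  C-step : ∀ b h → C (suc b) h ≈ shiftDown (C b) h + T h * C b (suc h)
  C-step b zero    = sym (+-identityˡ _)
  C-step b (suc h) = refl

  π-suc : ∀ h → π (suc h) ≈ π h * T h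
  π-suc h = prodT-snoc 0 h
    where
    prodT-snoc : ∀ a len → prodT R T a (suc len) ≈ prodT R T a len * T (a +ℕ len)
    prodT-snoc a zero      = trans (*-identityʳ _) (trans (reflexive (≡.cong T (≡.sym (ℕP.+-identityʳ a)))) (sym (*-identityˡ _)))
    prodT-snoc a (suc len) = trans (*-cong refl (prodT-snoc (suc a) len))
                               (trans (sym (*-assoc _ _ _)) (*-cong refl (reflexive (≡.cong T (≡.sym (ℕP.+-suc a len))))))

  module Pairing (M : ℕ) where

    pairing : (ℕ → Carrier) → (ℕ → Carrier) → Carrier
    pairing F G = ∑ℕ (suc M) (λ h → F h * (π h * G h))

    cross : (ℕ → Carrier) → (ℕ → Carrier) → Carrier
    cross F G = ∑ℕ M (λ h → T h * (F (suc h) * (π h * G h)))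

    pairing-comm : ∀ F G → pairing F G ≈ pairing G F
    pairing-comm F G = ∑ℕ-cong (suc M) (λ h _ → solve 3 (λ f p g → f :* (p :* g) := g :* (p :* f)) refl (F h) (π h) (G h))

    pairing-shiftDown : ∀ F G → pairing F (shiftDown G) ≈ cross F G
    pairing-shiftDown F G = trans (+-cong (trans (*-cong refl (zeroʳ _)) (zeroʳ _)) (∑ℕ-cong M (λ h _ → term h))) (+-identityˡ _)
      where
      term : ∀ h → F (suc h) * (π (suc h) * G h) ≈ T h * (F (suc h) * (π h * G h))
      term h = trans (*-cong refl (*-cong (π-suc h) refl))
                     (solve 4 (λ f g p t → f :* ((p :* t) :* g) := t :* (f :* (p :* g))) refl (F (suc h)) (G h) (π h) (T h))

    pairing-shiftUp : ∀ F G → F M * G (suc M) ≈ 0# → pairing F (λ h → T h * G (suc h)) ≈ cross G F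
    pairing-shiftUp F G boundary≈0 = begin
        pairing F (λ h → T h * G (suc h))
      ≈⟨ ∑ℕ-last M _ ⟩
        ∑ℕ M (λ h → F h * (π h * (T h * G (suc h)))) + F M * (π M * (T M * G (suc M)))
      ≈⟨ +-cong (∑ℕ-cong M (λ h _ → reorder (F h) (π h) (T h) (G (suc h)))) boundary ⟩
        cross G F + 0#
      ≈⟨ +-identityʳ _ ⟩
        cross G F ∎
      where
      reorder : ∀ f p t g → f * (p * (t * g)) ≈ t * (g * (p * f))
      reorder = solve 4 (λ f p t g → f :* (p :* (t :* g)) := t :* (g :* (p :* f))) refl
      boundary : F M * (π M * (T M * G (suc M))) ≈ 0#
      boundary = begin
        F M * (π M * (T M * G (suc M)))  ≈⟨ solve 4 (λ f p t g → f :* (p :* (t :* g)) := (p :* t) :* (f :* g)) refl (F M) (π M) (T M) (G (suc M)) ⟩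
        (π M * T M) * (F M * G (suc M))  ≈⟨ *-cong refl boundary≈0 ⟩
        (π M * T M) * 0#                 ≈⟨ zeroʳ _ ⟩
        0#                               ∎

    pairing-C-suc : ∀ F b → pairing F (C (suc b)) ≈ pairing F (shiftDown (C b)) + pairing F (λ h → T h * C b (suc h))
    pairing-C-suc F b = trans (∑ℕ-cong (suc M) (λ h _ → term h))
                              (∑ℕ-+ (suc M) (λ h → F h * (π h * shiftDown (C b) h)) (λ h → F h * (π h * (T h * C b (suc h)))))
      where
      term : ∀ h → F h * (π h * C (suc b) h) ≈ F h * (π h * shiftDown (C b) h) + F h * (π h * (T h * C b (suc h)))
      term h = trans (*-cong refl (trans (*-cong refl (C-step b h)) (distribˡ (π h) _ _))) (distribˡ (F h) _ _)

  transfer : ∀ a b M → a ℕ.< M → Pairing.pairing M (C a) (C (suc b)) ≈ Pairing.pairing M (C (suc a)) (C b)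
  transfer a b M a<M = begin
      pairing (C a) (C (suc b))
    ≈⟨ pairing-C-suc (C a) b ⟩
      pairing (C a) (shiftDown (C b)) + pairing (C a) (λ h → T h * C b (suc h))
    ≈⟨ +-cong (pairing-shiftDown (C a) (C b)) (pairing-shiftUp (C a) (C b) (trans (*-cong (C-above a<M) refl) (zeroˡ _))) ⟩
      cross (C a) (C b) + cross (C b) (C a)
    ≈⟨ +-comm _ _ ⟩
      cross (C b) (C a) + cross (C a) (C b)
    ≈⟨ +-cong (pairing-shiftDown (C b) (C a)) (pairing-shiftUp (C b) (C a) (trans (*-cong refl (C-above (ℕP.m<n⇒m<1+n a<M))) (zeroʳ _))) ⟨
      pairing (C b) (shiftDown (C a)) + pairing (C b) (λ h → T h * C a (suc h))
    ≈⟨ pairing-C-suc (C b) a ⟨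
      pairing (C b) (C (suc a))
    ≈⟨ pairing-comm (C b) (C (suc a)) ⟩
      pairing (C (suc a)) (C b) ∎
    where open Pairing M

  -- Cut a path of length a + b after a steps, at height h: the remaining part, reversed, is a path counted
  -- by C b h, with weights differing by π h.
  split : ∀ a b N → a ℕ.< N → C (a +ℕ b) 0 ≈ ∑ℕ N (λ h → C a h * (π h * C b h))
  split zero    b (suc N) _ = sym (trans (+-cong (trans (*-identityˡ _) (*-identityˡ _)) (∑ℕ-zero N (λ h _ → zeroˡ _))) (+-identityʳ _))
  split (suc a) b (suc N) (s≤s a<N) = begin
      C (suc a +ℕ b) 0                                     ≡⟨ ≡.cong (λ x → C x 0) (≡.sym (ℕP.+-suc a b)) ⟩
      C (a +ℕ suc b) 0                                     ≈⟨ split a (suc b) (suc N) (ℕP.m<n⇒m<1+n a<N) ⟩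
      ∑ℕ (suc N) (λ h → C a h * (π h * C (suc b) h))       ≈⟨ transfer a b N a<N ⟩
      ∑ℕ (suc N) (λ h → C (suc a) h * (π h * C b h))       ∎

  prodT-+ : ∀ a x y → prodT R T a (x +ℕ y) ≈ prodT R T a x * prodT R T (a +ℕ x) y
  prodT-+ a zero    y = trans (reflexive (≡.cong (λ z → prodT R T z y) (≡.sym (ℕP.+-identityʳ a)))) (sym (*-identityˡ _))
  prodT-+ a (suc x) y = trans (*-cong refl (prodT-+ (suc a) x y))
    (trans (sym (*-assoc _ _ _)) (*-cong refl (reflexive (≡.cong (λ z → prodT R T z y) (≡.sym (ℕP.+-suc a x))))))

  C-twoSteps : ∀ a h → C (suc (suc a)) h ≈
    shiftDown (shiftDown (C a)) h + (shiftDown T h + T h) * C a h + (T h * T (suc h)) * C a (suc (suc h))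
  C-twoSteps a zero =
    solve 4 (λ t₀ t₁ x y → t₀ :* (x :+ t₁ :* y) := con 0 :+ (con 0 :+ t₀) :* x :+ (t₀ :* t₁) :* y) refl (T 0) (T 1) (C a 0) (C a 2)
  C-twoSteps a (suc zero) =
    solve 5 (λ t₀ t₁ t₂ x y → t₀ :* x :+ t₁ :* (x :+ t₂ :* y) := con 0 :+ (t₀ :+ t₁) :* x :+ (t₁ :* t₂) :* y) refl
      (T 0) (T 1) (T 2) (C a 1) (C a 3)
  C-twoSteps a (suc (suc h)) =
    solve 6 (λ t₁ t₂ t₃ x y z → (x :+ t₁ :* y) :+ t₂ :* (y :+ t₃ :* z) := x :+ (t₁ :+ t₂) :* y :+ (t₂ :* t₃) :* z) refl
      (T (suc h)) (T (suc (suc h))) (T (suc (suc (suc h)))) (C a h) (C a (suc (suc h))) (C a (suc (suc (suc (suc h)))))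

-- r ∈ {0,1} selects the Hankel matrix (c_{i+j+r}); row i corresponds to height site i = r + 2i.
module Hankel {c ℓ : Level} (R : CommutativeRing c ℓ) (T : ℕ → CommutativeRing.Carrier R) (r : ℕ) (r≤1 : r ℕ.≤ 1) where

  open CommutativeRing R hiding (zero)
  open LinearAlgebra R
  open LatticePaths R T
  open SemiringSolver commutativeSemiring using (solve; _:+_; _:*_; _:=_; con)
  open SetoidReasoning setoid

  site : ℕ → ℕ
  site i = r +ℕ double i

  site-suc : ∀ i → site (suc i) ≡ suc (suc (site i))
  site-suc i = ≡.trans (ℕP.+-suc r (suc (double i))) (≡.cong suc (ℕP.+-suc r (double i)))

  site-mono-< : ∀ {i k} → i ℕ.< k → site i ℕ.< site k
  site-mono-< i<k = ℕP.+-monoʳ-< r (double-mono-< i<k)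

  site<double : ∀ {i N} → i ℕ.< N → site i ℕ.< double N
  site<double = offset-double-< r≤1

  L : ℕ → ℕ → Carrier
  L i k = C (site i) (site k)

  w : ℕ → Carrier
  w k = π (site k)

  H : ℕ → ℕ → Carrier
  H i j = C (site i +ℕ site j) 0

  hankel-entry : ∀ i j N → i ℕ.< N → H i j ≈ ∑ℕ N (λ k → L i k * (w k * L j k))
  hankel-entry i j N i<N = begin
    H i j                                                             ≈⟨ split (site i) (site j) (double N) (site<double i<N) ⟩
    ∑ℕ (double N) (λ h → C (site i) h * (π h * C (site j) h))         ≈⟨ ∑ℕ-pairs N _ ⟩
    ∑ℕ N (λ k → C (site i) (double k) * (π (double k) * C (site j) (double k))
              + C (site i) (suc (double k)) * (π (suc (double k)) * C (site j) (suc (double k))))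
                                                                      ≈⟨ ∑ℕ-cong N (λ k _ → oneParitySurvives r r≤1 k) ⟩
    ∑ℕ N (λ k → L i k * (w k * L j k))                                ∎
    where
    oneParitySurvives : ∀ r′ → r′ ℕ.≤ 1 → ∀ k →
      C (r′ +ℕ double i) (double k) * (π (double k) * C (r′ +ℕ double j) (double k))
        + C (r′ +ℕ double i) (suc (double k)) * (π (suc (double k)) * C (r′ +ℕ double j) (suc (double k)))
      ≈ C (r′ +ℕ double i) (r′ +ℕ double k) * (π (r′ +ℕ double k) * C (r′ +ℕ double j) (r′ +ℕ double k))
    oneParitySurvives zero       _ k = trans (+-cong refl (trans (*-cong (C-even-odd i k) refl) (zeroˡ _))) (+-identityʳ _)
    oneParitySurvives (suc zero) _ k = trans (+-cong (trans (*-cong (C-odd-even i k) refl) (zeroˡ _)) refl) (+-identityˡ _)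
    oneParitySurvives (suc (suc r′)) (s≤s ()) k

  Ω : ℕ → Carrier
  Ω n = ∏ n (λ k → w (toℕ k))

  Ω-suc : ∀ m → Ω (suc m) ≈ Ω m * w m
  Ω-suc m = trans (∏-last m (λ k → w (toℕ k)))
    (*-cong (∏-cong m (λ k → reflexive (≡.cong w (FinP.toℕ-inject₁ k)))) (reflexive (≡.cong w (FinP.toℕ-fromℕ m))))

  w-suc : ∀ m → w (suc m) ≈ w m * prodT R T (site m) 2
  w-suc m = trans (reflexive (≡.cong π (≡.trans (site-suc m) (ℕP.+-comm 2 (site m))))) (prodT-+ 0 (site m) 2)

  prodT-extend : ∀ m j → j ℕ.≤ m →
    prodT R T (r +ℕ 2 *ℕ j) (2 *ℕ suc m ∸ 2 *ℕ j) ≈ prodT R T (r +ℕ 2 *ℕ j) (2 *ℕ m ∸ 2 *ℕ j) * prodT R T (site m) 2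
  prodT-extend m j j≤m = begin
      prodT R T (r +ℕ 2 *ℕ j) (2 *ℕ suc m ∸ 2 *ℕ j)
    ≡⟨ ≡.cong (prodT R T (r +ℕ 2 *ℕ j)) length ⟩
      prodT R T (r +ℕ 2 *ℕ j) ((2 *ℕ m ∸ 2 *ℕ j) +ℕ 2)
    ≈⟨ prodT-+ (r +ℕ 2 *ℕ j) (2 *ℕ m ∸ 2 *ℕ j) 2 ⟩
      prodT R T (r +ℕ 2 *ℕ j) (2 *ℕ m ∸ 2 *ℕ j) * prodT R T ((r +ℕ 2 *ℕ j) +ℕ (2 *ℕ m ∸ 2 *ℕ j)) 2
    ≡⟨ ≡.cong (λ x → prodT R T (r +ℕ 2 *ℕ j) (2 *ℕ m ∸ 2 *ℕ j) * prodT R T x 2) endpoint ⟩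
      prodT R T (r +ℕ 2 *ℕ j) (2 *ℕ m ∸ 2 *ℕ j) * prodT R T (site m) 2 ∎
    where
    2j≤2m : 2 *ℕ j ℕ.≤ 2 *ℕ m
    2j≤2m = ℕP.*-monoʳ-≤ 2 j≤m
    length : 2 *ℕ suc m ∸ 2 *ℕ j ≡ (2 *ℕ m ∸ 2 *ℕ j) +ℕ 2
    length = ≡.trans (≡.cong (_∸ 2 *ℕ j) (≡.trans (ℕP.*-suc 2 m) (ℕP.+-comm 2 (2 *ℕ m)))) (ℕP.+-∸-comm 2 2j≤2m)
    endpoint : (r +ℕ 2 *ℕ j) +ℕ (2 *ℕ m ∸ 2 *ℕ j) ≡ site m
    endpoint = ≡.trans (ℕP.+-assoc r (2 *ℕ j) _) (≡.cong (r +ℕ_) (≡.trans (ℕP.m+[n∸m]≡n 2j≤2m) (≡.sym (double≡2* m))))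

  Wᴹ : ∀ n → Matrix n
  Wᴹ n i j = δ i j * w (toℕ j)

  det-Wᴹ : ∀ n → det R n (Wᴹ n) ≈ Ω n
  det-Wᴹ n = trans (det-lowerTriangular n (Wᴹ n) (λ i j i<j → trans (*-cong (δ-≢ (λ i≡j → ℕP.<-irrefl (≡.cong toℕ i≡j) i<j)) refl) (zeroˡ _)))
                   (∏-cong n (λ i → trans (*-cong (δ-refl i) refl) (*-identityˡ _)))

  det-sandwich : ∀ n (F P Q : Matrix n) → (∀ i j → F i j ≈ ∑ n (λ k → P i k * (w (toℕ k) * Q j k))) →
                 det R n F ≈ (det R n P * Ω n) * det R n Q
  det-sandwich n F P Q F≈ = begin
      det R n F
    ≈⟨ det-cong n (λ i j → trans (F≈ i j) (∑-cong n (λ k → sym (trans (*-cong (scaled P i k) refl) (*-assoc _ _ _))))) ⟩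
      det R n ((P *ᴹ Wᴹ n) *ᴹ (Q ᵀ))
    ≈⟨ det-* n _ _ ⟩
      det R n (P *ᴹ Wᴹ n) * det R n (Q ᵀ)
    ≈⟨ *-cong (trans (det-* n P (Wᴹ n)) (*-cong refl (det-Wᴹ n))) (det-transpose n Q) ⟩
      (det R n P * Ω n) * det R n Q ∎
    where
    scaled : ∀ (X : Matrix n) i j → (X *ᴹ Wᴹ n) i j ≈ X i j * w (toℕ j)
    scaled X i j = trans (∑-cong n (λ k → solve 3 (λ x d v → x :* (d :* v) := (v :* x) :* d) refl (X i k) (δ k j) (w (toℕ j))))
                         (trans (∑-δ n (λ k → w (toℕ j) * X i k) j) (*-comm _ _))

  Lᴹ : ∀ n → Matrix n
  Lᴹ n i k = L (toℕ i) (toℕ k)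

  det-Lᴹ : ∀ n → det R n (Lᴹ n) ≈ 1#
  det-Lᴹ n = trans (det-lowerTriangular n (Lᴹ n) (λ i k i<k → C-above (site-mono-< i<k))) (∏-one n (λ i → C-diagonal (site (toℕ i))))

  Hᴹ : ∀ n → Matrix n
  Hᴹ n i j = H (toℕ i) (toℕ j)

  det-Hᴹ : ∀ n → det R n (Hᴹ n) ≈ Ω n
  det-Hᴹ n = begin
    det R n (Hᴹ n)                              ≈⟨ det-sandwich n (Hᴹ n) (Lᴹ n) (Lᴹ n) entries ⟩
    (det R n (Lᴹ n) * Ω n) * det R n (Lᴹ n)     ≈⟨ *-cong (*-cong (det-Lᴹ n) refl) (det-Lᴹ n) ⟩
    (1# * Ω n) * 1#                             ≈⟨ trans (*-identityʳ _) (*-identityˡ _) ⟩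
    Ω n                                         ∎
    where
    entries : ∀ i j → Hᴹ n i j ≈ ∑ n (λ k → Lᴹ n i k * (w (toℕ k) * Lᴹ n j k))
    entries i j = trans (hankel-entry (toℕ i) (toℕ j) n (FinP.toℕ<n i)) (sym (∑-toℕ n (λ k → L (toℕ i) k * (w k * L (toℕ j) k))))

  lowerWeight : ℕ → Carrier
  lowerWeight zero    = 0#
  lowerWeight (suc k) = T (site k) * T (suc (site k))

  module ShiftedJacobi (α : Carrier) where

    open Tridiagonal (λ k → shiftDown T (site k) + T (site k) + α) (λ _ → 1#) lowerWeight public

    P : ℕ → ℕ → Carrier
    P i k = L (suc i) k + α * L i k

    P-factor : ∀ n i k → i ℕ.< n → k ℕ.< n → P i k ≈ ∑ℕ n (λ m → L i m * tridiagonal m k)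
    P-factor n i k i<n k<n = begin
        C (site (suc i)) (site k) + α * L i k
      ≡⟨ ≡.cong (λ x → C x (site k) + α * L i k) (site-suc i) ⟩
        C (suc (suc (site i))) (site k) + α * L i k
      ≈⟨ +-cong (C-twoSteps (site i) (site k)) refl ⟩
        shiftDown (shiftDown (C (site i))) (site k) + (shiftDown T (site k) + T (site k)) * L i k
          + lowerWeight (suc k) * C (site i) (suc (suc (site k))) + α * L i k
      ≈⟨ +-cong (+-cong (+-cong (twoBelow k) refl) (*-cong refl (reflexive (≡.cong (C (site i)) (≡.sym (site-suc k)))))) refl ⟩
        shiftDown (L i) k + (shiftDown T (site k) + T (site k)) * L i k + lowerWeight (suc k) * L i (suc k) + α * L i k
      ≈⟨ solve 7 (λ s t₋ t x l y a → s :+ (t₋ :+ t) :* x :+ l :* y :+ a :* x := x :* (t₋ :+ t :+ a) :+ s :* con 1 :+ y :* l) refl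
           (shiftDown (L i) k) (shiftDown T (site k)) (T (site k)) (L i k) (lowerWeight (suc k)) (L i (suc k)) α ⟩
        L i k * (shiftDown T (site k) + T (site k) + α) + shiftDown (L i) k * 1# + L i (suc k) * lowerWeight (suc k)
      ≈⟨ +-cong (+-cong (∑ℕ-δ n _ k k<n) (superdiagonal k k<n)) subdiagonal ⟨
        ∑ℕ n (λ m → (L i m * (shiftDown T (site m) + T (site m) + α)) * δℕ m k) + ∑ℕ n (λ m → (L i m * 1#) * δℕ (suc m) k)
          + ∑ℕ n (λ m → (L i m * lowerWeight m) * δℕ m (suc k))
      ≈⟨ trans (∑ℕ-+ n _ _) (+-cong (∑ℕ-+ n _ _) refl) ⟨
        ∑ℕ n (λ m → (L i m * (shiftDown T (site m) + T (site m) + α)) * δℕ m k + (L i m * 1#) * δℕ (suc m) k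
                   + (L i m * lowerWeight m) * δℕ m (suc k))
      ≈⟨ ∑ℕ-cong n (λ m _ → solve 7 (λ x d₁ e₁ e₂ e₃ u₁ l₁ → x :* d₁ :* e₁ :+ x :* u₁ :* e₂ :+ x :* l₁ :* e₃ := x :* (e₁ :* d₁ :+ e₂ :* u₁ :+ e₃ :* l₁)) refl
           (L i m) (shiftDown T (site m) + T (site m) + α) (δℕ m k) (δℕ (suc m) k) (δℕ m (suc k)) 1# (lowerWeight m)) ⟩
        ∑ℕ n (λ m → L i m * tridiagonal m k) ∎
      where
      twoBelow : ∀ k → shiftDown (shiftDown (C (site i))) (site k) ≈ shiftDown (L i) k
      twoBelow zero    = vanishesAt r r≤1
        where
        vanishesAt : ∀ r′ → r′ ℕ.≤ 1 → shiftDown (shiftDown (C (site i))) (r′ +ℕ 0) ≈ 0#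
        vanishesAt zero           _        = refl
        vanishesAt (suc zero)     _        = refl
        vanishesAt (suc (suc r′)) (s≤s ())
      twoBelow (suc k) = reflexive (≡.cong (shiftDown (shiftDown (C (site i)))) (site-suc k))
      superdiagonal : ∀ k → k ℕ.< n → ∑ℕ n (λ m → (L i m * 1#) * δℕ (suc m) k) ≈ shiftDown (L i) k * 1#
      superdiagonal zero    _   = trans (∑ℕ-zero n (λ m _ → trans (*-cong refl (δℕ-≢ {suc m} {0} (λ ()))) (zeroʳ _))) (sym (zeroˡ _))
      superdiagonal (suc k) k<n = ∑ℕ-δ n (λ m → L i m * 1#) k (ℕP.<-trans (ℕP.n<1+n k) k<n)
      subdiagonal : ∑ℕ n (λ m → (L i m * lowerWeight m) * δℕ m (suc k)) ≈ L i (suc k) * lowerWeight (suc k)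
      subdiagonal with suc k ℕ.<? n
      ... | yes k+1<n = ∑ℕ-δ n (λ m → L i m * lowerWeight m) (suc k) k+1<n
      ... | no k+1≮n  = trans (∑ℕ-δ-outside n _ (suc k) (ℕP.≮⇒≥ k+1≮n))
          (sym (trans (*-cong (C-above (site-mono-< (ℕP.<-≤-trans i<n (ℕP.≮⇒≥ k+1≮n)))) refl) (zeroˡ _)))

    P-last : ∀ n i → i ℕ.< n → P i n ≈ δℕ (suc i) n
    P-last n i i<n = trans (+-cong (leading (suc i ℕ.≟ n)) (trans (*-cong refl (C-above (site-mono-< i<n))) (zeroʳ _))) (+-identityʳ _)
      where
      leading : Dec (suc i ≡ n) → L (suc i) n ≈ δℕ (suc i) n
      leading (yes ≡.refl) = trans (C-diagonal (site (suc i))) (sym (δℕ-refl (suc i)))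
      leading (no i+1≢n)   = trans (C-above (site-mono-< (ℕP.≤∧≢⇒< i<n i+1≢n))) (sym (δℕ-≢ i+1≢n))

    Pᴹ : ∀ n → Matrix n
    Pᴹ n i k = P (toℕ i) (toℕ k)

    det-Pᴹ : ∀ n → det R n (Pᴹ n) ≈ continuant n
    det-Pᴹ n = begin
      det R n (Pᴹ n)                          ≈⟨ det-cong n (λ i k → trans (P-factor n (toℕ i) (toℕ k) (FinP.toℕ<n i) (FinP.toℕ<n k))
                                                    (sym (∑-toℕ n (λ m → L (toℕ i) m * tridiagonal m (toℕ k))))) ⟩
      det R n (Lᴹ n *ᴹ Tri n)                 ≈⟨ det-* n _ _ ⟩
      det R n (Lᴹ n) * continuant n           ≈⟨ trans (*-cong (det-Lᴹ n) refl) (*-identityˡ _) ⟩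
      continuant n                            ∎

  H-shift : ∀ i j → H i (suc j) ≡ H (suc i) j
  H-shift i j = ≡.cong (λ x → C x 0)
    (≡.trans (≡.cong (site i +ℕ_) (site-suc j))
    (≡.trans (ℕP.+-suc (site i) (suc (site j)))
    (≡.trans (≡.cong suc (ℕP.+-suc (site i) (site j)))
             (≡.sym (≡.cong (_+ℕ site j) (site-suc i))))))

  cseq-offset : ∀ i j → cseq R T (r +ℕ (i +ℕ j)) ≡ H i j
  cseq-offset i j = ≡.cong (λ x → C x 0)
    (≡.trans (twice r i j) (≡.cong₂ (λ x y → (r +ℕ x) +ℕ (r +ℕ y)) (≡.sym (double≡2* i)) (≡.sym (double≡2* j))))
    where
    twice : ∀ r i j → 2 *ℕ (r +ℕ (i +ℕ j)) ≡ (r +ℕ 2 *ℕ i) +ℕ (r +ℕ 2 *ℕ j)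
    twice = solve-∀

  module ModifiedHankel (α β : Carrier) where

    module Sα = ShiftedJacobi α
    module Sβ = ShiftedJacobi β

    M : ℕ → ℕ → Carrier
    M i j = (α * β) * H i j + (α + β) * H (suc i) j + H (suc i) (suc j)

    M-entry : ∀ n i j → i ℕ.< n → j ℕ.< n → M i j ≈ ∑ℕ (suc n) (λ k → Sα.P i k * (w k * Sβ.P j k))
    M-entry n i j i<n j<n = begin
        (α * β) * H i j + (α + β) * H (suc i) j + H (suc i) (suc j)
      ≈⟨ solve 6 (λ a b h₀₀ h₁₀ h₀₁ h₁₁ → (a :* b) :* h₀₀ :+ (a :+ b) :* h₁₀ :+ h₁₁ := h₁₁ :+ b :* h₁₀ :+ a :* h₁₀ :+ (a :* b) :* h₀₀) refl
           α β (H i j) (H (suc i) j) (H i (suc j)) (H (suc i) (suc j)) ⟩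
        H (suc i) (suc j) + β * H (suc i) j + α * H (suc i) j + (α * β) * H i j
      ≡⟨ ≡.cong (λ x → H (suc i) (suc j) + β * H (suc i) j + α * x + (α * β) * H i j) (H-shift i j) ⟨
        H (suc i) (suc j) + β * H (suc i) j + α * H i (suc j) + (α * β) * H i j
      ≈⟨ +-cong (+-cong (+-cong (entry (suc i) (suc j) (s≤s i<n)) (*-cong refl (entry (suc i) j (s≤s i<n))))
                        (*-cong refl (entry i (suc j) i<n+1))) (*-cong refl (entry i j i<n+1)) ⟩
        S (suc i) (suc j) + β * S (suc i) j + α * S i (suc j) + (α * β) * S i j
      ≈⟨ +-cong (+-cong (+-cong refl (*-distribˡ-∑ℕ (suc n) β (f (suc i) j))) (*-distribˡ-∑ℕ (suc n) α (f i (suc j))))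
                (*-distribˡ-∑ℕ (suc n) (α * β) (f i j)) ⟩
        S (suc i) (suc j) + ∑ℕ (suc n) (λ k → β * f (suc i) j k) + ∑ℕ (suc n) (λ k → α * f i (suc j) k)
          + ∑ℕ (suc n) (λ k → (α * β) * f i j k)
      ≈⟨ trans (∑ℕ-+ (suc n) (λ k → f₁₁ k + β * f (suc i) j k + α * f i (suc j) k) (λ k → (α * β) * f i j k))
               (+-cong (trans (∑ℕ-+ (suc n) (λ k → f₁₁ k + β * f (suc i) j k) (λ k → α * f i (suc j) k))
                              (+-cong (∑ℕ-+ (suc n) f₁₁ (λ k → β * f (suc i) j k)) refl)) refl) ⟨
        ∑ℕ (suc n) (λ k → f (suc i) (suc j) k + β * f (suc i) j k + α * f i (suc j) k + (α * β) * f i j k)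
      ≈⟨ ∑ℕ-cong (suc n) (λ k _ → solve 7 (λ a b x₁ x₀ v y₁ y₀ →
             x₁ :* (v :* y₁) :+ b :* (x₁ :* (v :* y₀)) :+ a :* (x₀ :* (v :* y₁)) :+ (a :* b) :* (x₀ :* (v :* y₀))
               := (x₁ :+ a :* x₀) :* (v :* (y₁ :+ b :* y₀)))
             refl α β (L (suc i) k) (L i k) (w k) (L (suc j) k) (L j k)) ⟩
        ∑ℕ (suc n) (λ k → Sα.P i k * (w k * Sβ.P j k)) ∎
      where
      i<n+1 : i ℕ.< suc n
      i<n+1 = ℕP.m<n⇒m<1+n i<n
      f : ℕ → ℕ → ℕ → Carrier
      f i′ j′ k = L i′ k * (w k * L j′ k)
      f₁₁ : ℕ → Carrier
      f₁₁ = f (suc i) (suc j)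
      S : ℕ → ℕ → Carrier
      S i′ j′ = ∑ℕ (suc n) (f i′ j′)
      entry : ∀ i′ j′ → i′ ℕ.< suc n → H i′ j′ ≈ S i′ j′
      entry i′ j′ = hankel-entry i′ j′ (suc n)

    Mᴹ : ∀ n → Matrix n
    Mᴹ n i j = M (toℕ i) (toℕ j)

    Aᴹ : ∀ n → Matrix n
    Aᴹ n i j = ∑ n (λ k → Sα.Pᴹ n i k * (w (toℕ k) * Sβ.Pᴹ n j k))

    Aᴹ-entry : ∀ n i j → Aᴹ n i j ≈ ∑ℕ n (λ k → Sα.P (toℕ i) k * (w k * Sβ.P (toℕ j) k))
    Aᴹ-entry n i j = ∑-toℕ n (λ k → Sα.P (toℕ i) k * (w k * Sβ.P (toℕ j) k))

    det-Aᴹ : ∀ n → det R n (Aᴹ n) ≈ (Sα.continuant n * Ω n) * Sβ.continuant n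
    det-Aᴹ n = trans (det-sandwich n (Aᴹ n) (Sα.Pᴹ n) (Sβ.Pᴹ n) (λ _ _ → refl)) (*-cong (*-cong (Sα.det-Pᴹ n) refl) (Sβ.det-Pᴹ n))

    Mᴹ-suc-entry : ∀ m i j → Mᴹ (suc m) i j ≈ Aᴹ (suc m) i j + δℕ (toℕ i) m * (w (suc m) * δℕ (toℕ j) m)
    Mᴹ-suc-entry m i j = begin
        M (toℕ i) (toℕ j)
      ≈⟨ M-entry (suc m) (toℕ i) (toℕ j) (FinP.toℕ<n i) (FinP.toℕ<n j) ⟩
        ∑ℕ (suc (suc m)) (λ k → Sα.P (toℕ i) k * (w k * Sβ.P (toℕ j) k))
      ≈⟨ ∑ℕ-last (suc m) (λ k → Sα.P (toℕ i) k * (w k * Sβ.P (toℕ j) k)) ⟩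
        ∑ℕ (suc m) (λ k → Sα.P (toℕ i) k * (w k * Sβ.P (toℕ j) k)) + Sα.P (toℕ i) (suc m) * (w (suc m) * Sβ.P (toℕ j) (suc m))
      ≈⟨ +-cong (sym (Aᴹ-entry (suc m) i j))
                (*-cong (Sα.P-last (suc m) (toℕ i) (FinP.toℕ<n i)) (*-cong refl (Sβ.P-last (suc m) (toℕ j) (FinP.toℕ<n j)))) ⟩
        Aᴹ (suc m) i j + δℕ (toℕ i) m * (w (suc m) * δℕ (toℕ j) m) ∎

    det-Mᴹ-suc : ∀ m → det R (suc m) (Mᴹ (suc m)) ≈
                 (Sα.continuant (suc m) * Ω (suc m)) * Sβ.continuant (suc m) + w (suc m) * det R m (Mᴹ m)
    det-Mᴹ-suc m = begin
        det R (suc m) (Mᴹ (suc m))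
      ≈⟨ det-cornerUpdate m (Mᴹ (suc m)) (Aᴹ (suc m)) (w (suc m)) others lastRow ⟩
        det R (suc m) (Aᴹ (suc m)) + w (suc m) * det R m (topLeft (Aᴹ (suc m)))
      ≈⟨ +-cong (det-Aᴹ (suc m)) (*-cong refl (det-cong m topLeftA≈M)) ⟩
        (Sα.continuant (suc m) * Ω (suc m)) * Sβ.continuant (suc m) + w (suc m) * det R m (Mᴹ m) ∎
      where
      Last : Fin (suc m)
      Last = fromℕ m
      others : ∀ i j → i ≢ Last → Mᴹ (suc m) i j ≈ Aᴹ (suc m) i j
      others i j i≢Last = trans (Mᴹ-suc-entry m i j) (trans (+-cong refl (trans (*-cong (δℕ-≢ i≢m) refl) (zeroˡ _))) (+-identityʳ _))
        where
        i≢m : toℕ i ≢ m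
        i≢m eq = i≢Last (FinP.toℕ-injective (≡.trans eq (≡.sym (FinP.toℕ-fromℕ m))))
      lastRow : ∀ j → Mᴹ (suc m) Last j ≈ Aᴹ (suc m) Last j + w (suc m) * δ Last j
      lastRow j = trans (Mᴹ-suc-entry m Last j) (+-cong refl (begin
          δℕ (toℕ Last) m * (w (suc m) * δℕ (toℕ j) m)
        ≈⟨ *-cong (trans (reflexive (≡.cong (λ x → δℕ x m) (FinP.toℕ-fromℕ m))) (δℕ-refl m)) refl ⟩
          1# * (w (suc m) * δℕ (toℕ j) m)
        ≈⟨ *-identityˡ _ ⟩
          w (suc m) * δℕ (toℕ j) m
        ≈⟨ *-cong refl (trans (δℕ-sym (toℕ j) m)
             (trans (reflexive (≡.cong (λ x → δℕ x (toℕ j)) (≡.sym (FinP.toℕ-fromℕ m)))) (sym (δ≈δℕ Last j)))) ⟩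
          w (suc m) * δ Last j ∎))
      topLeftA≈M : ∀ a b → topLeft (Aᴹ (suc m)) a b ≈ Mᴹ m a b
      topLeftA≈M a b = begin
          Aᴹ (suc m) (inject₁ a) (inject₁ b)
        ≈⟨ Aᴹ-entry (suc m) (inject₁ a) (inject₁ b) ⟩
          ∑ℕ (suc m) (λ k → Sα.P (toℕ (inject₁ a)) k * (w k * Sβ.P (toℕ (inject₁ b)) k))
        ≡⟨ ≡.cong₂ (λ x y → ∑ℕ (suc m) (λ k → Sα.P x k * (w k * Sβ.P y k))) (FinP.toℕ-inject₁ a) (FinP.toℕ-inject₁ b) ⟩
          ∑ℕ (suc m) (λ k → Sα.P (toℕ a) k * (w k * Sβ.P (toℕ b) k))
        ≈⟨ M-entry m (toℕ a) (toℕ b) (FinP.toℕ<n a) (FinP.toℕ<n b) ⟨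
          Mᴹ m a b ∎

    S : ℕ → Carrier
    S n = Σto R n (λ j → prodT R T (r +ℕ 2 *ℕ j) (2 *ℕ n ∸ 2 *ℕ j) * (Sα.continuant j * Sβ.continuant j))

    S-suc : ∀ m → S (suc m) ≈ S m * prodT R T (site m) 2 + Sα.continuant (suc m) * Sβ.continuant (suc m)
    S-suc m = +-cong (trans (Σto-cong≤ m term) (Σto-*ʳ m _ (prodT R T (site m) 2)))
                     (trans (*-cong (reflexive (≡.cong (prodT R T (r +ℕ 2 *ℕ suc m)) (ℕP.n∸n≡0 (2 *ℕ suc m)))) refl) (*-identityˡ _))
      where
      term : ∀ j → j ℕ.≤ m →
        prodT R T (r +ℕ 2 *ℕ j) (2 *ℕ suc m ∸ 2 *ℕ j) * (Sα.continuant j * Sβ.continuant j)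
          ≈ (prodT R T (r +ℕ 2 *ℕ j) (2 *ℕ m ∸ 2 *ℕ j) * (Sα.continuant j * Sβ.continuant j)) * prodT R T (site m) 2
      term j j≤m = trans (*-cong (prodT-extend m j j≤m) refl)
        (solve 3 (λ p l g → (p :* l) :* g := (p :* g) :* l) refl
           (prodT R T (r +ℕ 2 *ℕ j) (2 *ℕ m ∸ 2 *ℕ j)) (prodT R T (site m) 2) (Sα.continuant j * Sβ.continuant j))

    det-Mᴹ : ∀ n → det R n (Mᴹ n) ≈ Ω n * S n
    det-Mᴹ zero    = sym (trans (*-identityˡ _) (trans (*-identityˡ _) (*-identityˡ _)))
    det-Mᴹ (suc m) = begin
        det R (suc m) (Mᴹ (suc m))
      ≈⟨ det-Mᴹ-suc m ⟩
        (Gα * Ω (suc m)) * Gβ + w (suc m) * det R m (Mᴹ m)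
      ≈⟨ +-cong (*-cong (*-cong refl (Ω-suc m)) refl) (*-cong (w-suc m) (det-Mᴹ m)) ⟩
        (Gα * (Ω m * w m)) * Gβ + (w m * λₘ) * (Ω m * S m)
      ≈⟨ solve 6 (λ ga gb om wm l s → (ga :* (om :* wm)) :* gb :+ (wm :* l) :* (om :* s) := (om :* wm) :* (s :* l :+ ga :* gb)) refl
           Gα Gβ (Ω m) (w m) λₘ (S m) ⟩
        (Ω m * w m) * (S m * λₘ + Gα * Gβ)
      ≈⟨ *-cong (Ω-suc m) (S-suc m) ⟨
        Ω (suc m) * S (suc m) ∎
      where
      Gα Gβ λₘ : Carrier
      Gα = Sα.continuant (suc m)
      Gβ = Sβ.continuant (suc m)
      λₘ = prodT R T (site m) 2

    modified-det : ∀ n → det R n (λ i j → let x = r +ℕ (toℕ i +ℕ toℕ j) in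
                           (α * β) * cseq R T x + (α + β) * cseq R T (suc x) + cseq R T (suc (suc x))) ≈ Ω n * S n
    modified-det n = trans (det-cong n (λ i j → reflexive (entry (toℕ i) (toℕ j)))) (det-Mᴹ n)
      where
      entry : ∀ i j → (α * β) * cseq R T (r +ℕ (i +ℕ j)) + (α + β) * cseq R T (suc (r +ℕ (i +ℕ j))) + cseq R T (suc (suc (r +ℕ (i +ℕ j))))
                      ≡ M i j
      entry i j = ≡.trans (≡.cong (λ x → (α * β) * x + (α + β) * cseq R T (suc s) + cseq R T (suc (suc s))) (cseq-offset i j))
                          (≡.cong₂ (λ x y → (α * β) * H i j + (α + β) * x + y)
                                   (≡.trans (≡.cong (cseq R T) (step₁ r i j)) (cseq-offset (suc i) j))
                                   (≡.trans (≡.cong (cseq R T) (step₂ r i j)) (cseq-offset (suc i) (suc j))))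
        where
        s : ℕ
        s = r +ℕ (i +ℕ j)
        step₁ : ∀ r i j → suc (r +ℕ (i +ℕ j)) ≡ r +ℕ (suc i +ℕ j)
        step₁ = solve-∀
        step₂ : ∀ r i j → suc (suc (r +ℕ (i +ℕ j))) ≡ r +ℕ (suc i +ℕ suc j)
        step₂ = solve-∀

  hankel-det : ∀ n → det R n (λ i j → cseq R T (r +ℕ (toℕ i +ℕ toℕ j))) ≈ Ω n
  hankel-det n = trans (det-cong n (λ i j → reflexive (cseq-offset (toℕ i) (toℕ j)))) (det-Hᴹ n)

module Continuants {c ℓ : Level} (R : CommutativeRing c ℓ) (T : ℕ → CommutativeRing.Carrier R) where

  open CommutativeRing R hiding (zero)
  open SemiringSolver commutativeSemiring using (solve; _:+_; _:*_; _:=_; con)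
  open SetoidReasoning setoid
  module Even = Hankel R T 0 z≤n
  module Odd  = Hankel R T 1 (s≤s z≤n)

  x+z≈y⇒x≈y-z : ∀ {x y z} → x + z ≈ y → x ≈ y - z
  x+z≈y⇒x≈y-z {x} {y} {z} x+z≈y = begin
    x               ≈⟨ +-identityʳ x ⟨
    x + 0#          ≈⟨ +-cong refl (-‿inverseʳ z) ⟨
    x + (z - z)     ≈⟨ +-assoc x z (- z) ⟨
    (x + z) - z     ≈⟨ +-cong x+z≈y refl ⟩
    y - z           ∎

  gE≈continuant : ∀ α n → Even.ShiftedJacobi.continuant α n ≈ gE R T α n
  gE≈continuant α = Even.ShiftedJacobi.continuant-unique α (gE R T α) refl
    (solve 2 (λ a t → a :* con 1 :+ t :* con 1 := con 0 :+ t :+ a) refl α (T 0)) recursion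
    where
    recursion : ∀ n → gE R T α (suc (suc n)) ≈
      (T (suc (double n)) + T (suc (suc (double n))) + α) * gE R T α (suc n) - (1# * (T (double n) * T (suc (double n)))) * gE R T α n
    recursion n = x+z≈y⇒x≈y-z (begin
        gE R T α (suc (suc n)) + (1# * (T (double n) * T (suc (double n)))) * gE R T α n
      ≡⟨ ≡.cong (λ k → gE R T α (suc (suc n)) + (1# * (T k * T (suc k))) * gE R T α n) (double≡2* n) ⟩
        gE R T α (suc (suc n)) + (1# * (T (2 *ℕ n) * T (suc (2 *ℕ n)))) * gE R T α n
      ≈⟨ solve 6 (λ a t₀ t₁ t₂ O₀ E₀ →
             a :* ((a :* O₀ :+ t₀ :* E₀) :+ t₁ :* O₀) :+ t₂ :* (a :* O₀ :+ t₀ :* E₀) :+ (con 1 :* (t₀ :* t₁)) :* E₀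
               := (t₁ :+ t₂ :+ a) :* (a :* O₀ :+ t₀ :* E₀)) refl
           α (T (2 *ℕ n)) (T (suc (2 *ℕ n))) (T (2 *ℕ suc n)) (gO R T α n) (gE R T α n) ⟩
        (T (suc (2 *ℕ n)) + T (2 *ℕ suc n) + α) * gE R T α (suc n)
      ≡⟨ ≡.cong₂ (λ k k′ → (T (suc k) + T k′ + α) * gE R T α (suc n)) (double≡2* n) (double≡2* (suc n)) ⟨
        (T (suc (double n)) + T (suc (suc (double n))) + α) * gE R T α (suc n) ∎)

  gO≈continuant : ∀ α n → Odd.ShiftedJacobi.continuant α n ≈ gO R T α n
  gO≈continuant α = Odd.ShiftedJacobi.continuant-unique α (gO R T α) refl
    (solve 3 (λ a t₀ t₁ → (a :* con 1 :+ t₀ :* con 1) :+ t₁ :* con 1 := t₀ :+ t₁ :+ a) refl α (T 0) (T 1)) recursion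
    where
    recursion : ∀ n → gO R T α (suc (suc n)) ≈
      (T (suc (suc (double n))) + T (suc (suc (suc (double n)))) + α) * gO R T α (suc n)
        - (1# * (T (suc (double n)) * T (suc (suc (double n))))) * gO R T α n
    recursion n = x+z≈y⇒x≈y-z (begin
        gO R T α (suc (suc n)) + (1# * (T (suc (double n)) * T (suc (suc (double n))))) * gO R T α n
      ≡⟨ ≡.cong₂ (λ k k′ → gO R T α (suc (suc n)) + (1# * (T (suc k) * T k′)) * gO R T α n) (double≡2* n) (double≡2* (suc n)) ⟩
        gO R T α (suc (suc n)) + (1# * (T (suc (2 *ℕ n)) * T (2 *ℕ suc n))) * gO R T α n
      ≈⟨ solve 6 (λ a E₁ O₀ t₁ t₂ t₃ →
             (a :* (E₁ :+ t₁ :* O₀) :+ t₂ :* E₁) :+ t₃ :* (E₁ :+ t₁ :* O₀) :+ (con 1 :* (t₁ :* t₂)) :* O₀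
               := (t₂ :+ t₃ :+ a) :* (E₁ :+ t₁ :* O₀)) refl
           α (gE R T α (suc n)) (gO R T α n) (T (suc (2 *ℕ n))) (T (2 *ℕ suc n)) (T (suc (2 *ℕ suc n))) ⟩
        (T (2 *ℕ suc n) + T (suc (2 *ℕ suc n)) + α) * gO R T α (suc n)
      ≡⟨ ≡.cong (λ k → (T k + T (suc k) + α) * gO R T α (suc n)) (double≡2* (suc n)) ⟨
        (T (suc (suc (double n))) + T (suc (suc (suc (double n)))) + α) * gO R T α (suc n) ∎)

module InField {c ℓ : Level} (R : CommutativeRing c ℓ) (F : IsField R) where

  open CommutativeRing R hiding (zero)
  open IsField F
  open SetoidReasoning setoid

  *-≉0 : ∀ {x y} → ¬ (x ≈ 0#) → ¬ (y ≈ 0#) → ¬ (x * y ≈ 0#)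
  *-≉0 {x} {y} x≉0 y≉0 xy≈0 with inverse x x≉0
  ... | x⁻¹ , xx⁻¹≈1 = y≉0 (begin
    y                ≈⟨ *-identityˡ y ⟨
    1# * y           ≈⟨ *-cong xx⁻¹≈1 refl ⟨
    (x * x⁻¹) * y    ≈⟨ *-cong (*-comm x x⁻¹) refl ⟩
    (x⁻¹ * x) * y    ≈⟨ *-assoc x⁻¹ x y ⟩
    x⁻¹ * (x * y)    ≈⟨ *-cong refl xy≈0 ⟩
    x⁻¹ * 0#         ≈⟨ zeroʳ x⁻¹ ⟩
    0#               ∎)

  ∏-≉0 : ∀ n (f : Fin n → Carrier) → (∀ i → ¬ (f i ≈ 0#)) → ¬ (LinearAlgebra.∏ R n f ≈ 0#)
  ∏-≉0 zero    f f≉0 = 1≉0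
  ∏-≉0 (suc n) f f≉0 = *-≉0 (f≉0 zero) (∏-≉0 n (λ i → f (suc i)) (λ i → f≉0 (suc i)))

  module _ (T : ℕ → Carrier) (T≉0 : ∀ m → ¬ (T m ≈ 0#)) where

    prodT-≉0 : ∀ a len → ¬ (prodT R T a len ≈ 0#)
    prodT-≉0 a zero      = 1≉0
    prodT-≉0 a (suc len) = *-≉0 (T≉0 a) (prodT-≉0 (suc a) len)

    module Identities (r : ℕ) (r≤1 : r ℕ.≤ 1) (α β : Carrier) (g : Carrier → ℕ → Carrier)
                      (continuant≈g : ∀ γ n → Hankel.ShiftedJacobi.continuant R T r r≤1 γ n ≈ g γ n) (n : ℕ) where

      open Hankel R T r r≤1
      open LinearAlgebra R using (Σto-cong≤)

      hankel≉0 : ¬ (det R n (λ i j → cseq R T (r +ℕ (toℕ i +ℕ toℕ j))) ≈ 0#)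
      hankel≉0 det≈0 = ∏-≉0 n (λ k → w (toℕ k)) (λ k → prodT-≉0 0 (site (toℕ k))) (trans (sym (hankel-det n)) det≈0)

      christoffel : det R n (λ i j → let x = r +ℕ (toℕ i +ℕ toℕ j) in
                                (α * β) * cseq R T x + (α + β) * cseq R T (suc x) + cseq R T (suc (suc x)))
                    ≈ det R n (λ i j → cseq R T (r +ℕ (toℕ i +ℕ toℕ j)))
                      * Σto R n (λ j → prodT R T (r +ℕ 2 *ℕ j) (2 *ℕ n ∸ 2 *ℕ j) * (g α j * g β j))
      christoffel = trans (ModifiedHankel.modified-det α β n)
        (*-cong (sym (hankel-det n)) (Σto-cong≤ n (λ j _ → *-cong refl (*-cong (continuant≈g α j) (continuant≈g β j)))))

-- Both identities hold for n = 0 too.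
corollary2 : {c ℓ : Level} (R : CommutativeRing c ℓ) → IsField R →
    let open CommutativeRing R in
    (T : ℕ → Carrier) → (∀ m → ¬ (T m ≈ 0#)) → (α β : Carrier) → (n : ℕ) → n ≥ 1 →
    ((¬ (det R n (λ i j → cseq R T (toℕ i +ℕ toℕ j)) ≈ 0#))
     × (det R n (λ i j → ((α * β) * cseq R T (toℕ i +ℕ toℕ j) + (α + β) * cseq R T (suc (toℕ i +ℕ toℕ j))) + cseq R T (suc (suc (toℕ i +ℕ toℕ j))))
        ≈ det R n (λ i j → cseq R T (toℕ i +ℕ toℕ j))
          * Σto R n (λ j → prodT R T (2 *ℕ j) (2 *ℕ n ∸ 2 *ℕ j) * (gE R T α j * gE R T β j))))
    × ((¬ (det R n (λ i j → cseq R T (suc (toℕ i +ℕ toℕ j))) ≈ 0#))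
     × (det R n (λ i j → ((α * β) * cseq R T (suc (toℕ i +ℕ toℕ j)) + (α + β) * cseq R T (suc (suc (toℕ i +ℕ toℕ j)))) + cseq R T (suc (suc (suc (toℕ i +ℕ toℕ j)))))
        ≈ det R n (λ i j → cseq R T (suc (toℕ i +ℕ toℕ j)))
          * Σto R n (λ j → prodT R T (suc (2 *ℕ j)) (2 *ℕ n ∸ 2 *ℕ j) * (gO R T α j * gO R T β j))))
corollary2 R F T T≉0 α β n _ = (Even.hankel≉0 , Even.christoffel) , (Odd.hankel≉0 , Odd.christoffel)
  where
  open InField R F
  module Even = Identities T T≉0 0 z≤n α β (gE R T) (Continuants.gE≈continuant R T) n
  module Odd  = Identities T T≉0 1 (s≤s z≤n) α β (gO R T) (Continuants.gO≈continuant R T) n
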